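{- Let $S$ be a finite commutative Clifford semigroup and $K$ a field. Suppose that either (i) $K$ is a splitting field of $S$, or (ii) ${\rm Char}(K)=p$ and $\exp(S)$ is a power of $p$ for some prime $p$. Then for each $a\in S$: $\epsilon_a=0$, the $\mathcal{H}$-class $H_a$ is the maximal subgroup of $S$ containing $a$, and $\Gamma(H_a)\cong H_a$. In particular, $$d(S,K)=\max_{a\in S}\{d(\Gamma(H_a),K)\}=\max_H\{d(H,K)\},$$ where $H$ runs over all subgroups of $S$.
   Context: All semigroups are commutative, written additively; $\langle x\rangle=\{mx:m\ge1\}$; $\epsilon_a=0$ if $\langle a\rangle$ is a group and $1$ otherwise. A commutative semigroup is Clifford if for each $a$ there is $a'$ with $a+a'+a=a$ and $a'+a+a'=a'$. $e(x)$ denotes the unique idempotent in $\langle x\rangle$; $\exp(S)$ is the lcm of the periods of elements of $S$ (period of $x$: least $n>0$ with $(k+n)x=kx$, $k$ the index). $K$ is a splitting field of $S$ if $\#\{\zeta\in K:\zeta^n=1\}=n$, $n=\exp(S)$. $K[X;S]$ is the semigroup ring with basis $\{X^s\}$, $X^sX^t=X^{s+t}$. $d(S,K)$ is the supremum of all $\ell$ for which some sequence $s_1\cdots s_\ell$ over $S$ satisfies $\prod_{i}(X^{s_i}-a_iX^{e(s_i)})\ne0$ for all nonzero $a_i\in K$; for a group this is the usual invariant with $e(g)$ the identity. $(a)=\{a\}\cup(a+S)$; $a\,\mathcal{H}\,b$ iff $(a)=(b)$; $H_a$ is the class of $a$. ${\rm St}(H_a)=\{c:c+H_a\subseteq H_a\}$,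 $\gamma_c(x)=c+x$ on $H_a$, and $\Gamma(H_a)=\{\gamma_c:c\in{\rm St}(H_a)\}$ with $\gamma_c+\gamma_d=\gamma_{c+d}$ (Schützenberger group). -}

module Defs where

open import Level using (Level; _⊔_) renaming (suc to lsuc)
open import Data.Nat using (ℕ; zero; suc; _<_; _≤_) renaming (_+_ to _+ℕ_)
open import Data.Nat.Divisibility using (_∣_)
open import Data.Fin using (Fin) renaming (zero to fzero; suc to fsuc; _<_ to _<ᶠ_)
open import Data.Fin.Properties using (_≟_; any?; all?) renaming (_<?_ to _<ᶠ?_)
open import Data.List using (List; []; _∷_; foldr; filter; length)
open import Data.List.Relation.Unary.All using (All)
open import Data.List.Relation.Unary.Any using (Any)
open import Data.List.Relation.Unary.AllPairs using (AllPairs)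
open import Data.Fin.Base using () renaming (_<_ to _<F_)
open import Data.List using (List)
open import Data.Product using (Σ; ∃; _×_; _,_)
open import Data.Sum using (_⊎_)
open import Data.Bool using (if_then_else_)
open import Relation.Nullary using (¬_; Dec; does)
open import Relation.Nullary.Decidable using (_×-dec_; _⊎-dec_; _→-dec_; ¬?)
open import Relation.Binary.PropositionalEquality using (_≡_)
open import Algebra.Bundles using (CommutativeRing)
open import Data.List using () renaming (tabulate to ltab)

record Field (c ℓ : Level) : Set (lsuc (c ⊔ ℓ)) where
  field
    commutativeRing : CommutativeRing c ℓ
  open CommutativeRing commutativeRing public
  field
    1≉0 : ¬ (1# ≈ 0#)
    inverse : ∀ x → ¬ (x ≈ 0#) → ∃ λ y → (x * y) ≈ 1#

module _ {c ℓ : Level} (K : Field c ℓ) where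
  open Field K

  natCast : ℕ → Carrier
  natCast zero = 0#
  natCast (suc m) = 1# + natCast m

  powK : Carrier → ℕ → Carrier
  powK ζ zero = 1#
  powK ζ (suc m) = ζ * powK ζ m

  CharIs : ℕ → Set ℓ
  CharIs p = (0 < p) × (natCast p ≈ 0#) × (∀ m → 0 < m → m < p → ¬ (natCast m ≈ 0#))

  RootsOfUnityCount : ℕ → Set (c ⊔ ℓ)
  RootsOfUnityCount N =
    Σ (List Carrier) λ l →
      (length l ≡ N) × All (λ ζ → powK ζ N ≈ 1#) l
      × AllPairs (λ x y → ¬ (x ≈ y)) l
      × (∀ ζ → powK ζ N ≈ 1# → Any (λ z → ζ ≈ z) l)

record FinCommSemigroup : Set where
  field
    size : ℕ
    _⊕_ : Fin size → Fin size → Fin size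
    assoc : ∀ x y z → (x ⊕ y) ⊕ z ≡ x ⊕ (y ⊕ z)
    comm : ∀ x y → x ⊕ y ≡ y ⊕ x

module _ (S : FinCommSemigroup) where
  open FinCommSemigroup S

  -- mulSuc m x = (m+1) x
  mulSuc : ℕ → Fin size → Fin size
  mulSuc zero x = x
  mulSuc (suc m) x = x ⊕ mulSuc m x

  InCyc : Fin size → Fin size → Set
  InCyc a y = ∃ λ m → y ≡ mulSuc m a

  Rec : Fin size → ℕ → ℕ → Set
  Rec x i p = (0 < p) × (mulSuc (i +ℕ p) x ≡ mulSuc i x)

  -- the period of x is p (the index of x being i+1)
  IsPeriod : Fin size → ℕ → Set
  IsPeriod x p = ∃ λ i →
      (∀ j → j < i → ¬ (∃ λ q → Rec x j q))
    × Rec x i p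
    × (∀ q → 0 < q → q < p → ¬ Rec x i q)

  IsExp : ℕ → Set
  IsExp N = (∀ x p → IsPeriod x p → p ∣ N)
          × (∀ M → (∀ x p → IsPeriod x p → p ∣ M) → N ∣ M)

  IsClifford : Set
  IsClifford = ∀ a → ∃ λ a' → ((a ⊕ a') ⊕ a ≡ a) × ((a' ⊕ a) ⊕ a' ≡ a')

  IsSubgroup : (Fin size → Set) → Set
  IsSubgroup P = (∀ x y → P x → P y → P (x ⊕ y))
    × ∃ λ e → P e × (∀ x → P x → e ⊕ x ≡ x)
                  × (∀ x → P x → ∃ λ y → P y × (x ⊕ y ≡ e))

  -- ε_a = 0  iff  ⟨a⟩ is a group
  εIsZero : Fin size → Set
  εIsZero a = IsSubgroup (InCyc a)

  InPrin : Fin size → Fin size → Set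
  InPrin a y = (y ≡ a) ⊎ ∃ λ s → y ≡ a ⊕ s

  InPrin? : ∀ a y → Dec (InPrin a y)
  InPrin? a y = (y ≟ a) ⊎-dec any? (λ s → y ≟ (a ⊕ s))

  HRel : Fin size → Fin size → Set
  HRel a b = ∀ y → (InPrin a y → InPrin b y) × (InPrin b y → InPrin a y)

  HRel? : ∀ a b → Dec (HRel a b)
  HRel? a b = all? (λ y → (InPrin? a y →-dec InPrin? b y) ×-dec (InPrin? b y →-dec InPrin? a y))

  H : Fin size → Fin size → Set
  H a x = HRel x a

  H? : ∀ a x → Dec (H a x)
  H? a x = HRel? x a

  St : Fin size → Fin size → Set
  St a c = ∀ x → H a x → H a (c ⊕ x)

  St? : ∀ a c → Dec (St a c)
  St? a c = all? (λ x → H? a x →-dec H? a (c ⊕ x))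

  γEq : Fin size → Fin size → Fin size → Set
  γEq a c d = ∀ x → H a x → c ⊕ x ≡ d ⊕ x

  γEq? : ∀ a c d → Dec (γEq a c d)
  γEq? a c d = all? (λ x → H? a x →-dec (c ⊕ x) ≟ (d ⊕ x))

  -- Γ(H_a) ≅ H_a : Γ(H_a) is St(H_a) with c, d identified iff γ_c = γ_d
  -- (c ↦ γ_c), and the operation γ_c + γ_d = γ_{c+d}.
  SchutzenbergerIso : Fin size → Set
  SchutzenbergerIso a = ∃ λ (φ : Fin size → Fin size) →
      (∀ c → St a c → H a (φ c))
    × (∀ c d → St a c → St a d → γEq a c d → φ c ≡ φ d)
    × (∀ c d → St a c → St a d → φ c ≡ φ d → γEq a c d)
    × (∀ h → H a h → ∃ λ c → St a c × (φ c ≡ h))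
    × (∀ c d → St a c → St a d → φ (c ⊕ d) ≡ φ c ⊕ φ d)

  -- The invariant d(T, K) for a finite commutative semigroup T that is
  -- presented as a subquotient of S: elements are those x with P x,
  -- and x, y are identified iff E x y (E a congruence on P).
  -- Instances: T = S (P = ⊤, E = ≡); T = a subgroup H (P = ∈ H, E = ≡);
  -- T = Γ(H_a) (P = St(H_a), E = γEq a).
  module DInv {c ℓ : Level} (K : Field c ℓ)
              (P : Fin size → Set) (P? : ∀ x → Dec (P x))
              (E : Fin size → Fin size → Set) (E? : ∀ x y → Dec (E x y)) where
    open Field K

    -- one representative per E-class of P-elements (the least index)
    reps : List (Fin size)
    reps = filter (λ i → P? i ×-dec ¬? (any? (λ j → (j <ᶠ? i) ×-dec (P? j ×-dec E? j i))))
                  (ltab (λ i → i))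

    -- elements of K[X;T] : coefficient functions (E-invariant on P)
    Elt : Set c
    Elt = Fin size → Carrier

    sumReps : (Fin size → Carrier) → Carrier
    sumReps f = foldr (λ i acc → f i + acc) 0# reps

    X^ : Fin size → Elt
    X^ s t = if does (E? t s) then 1# else 0#

    _·_ : Elt → Elt → Elt
    (f · g) s = sumReps λ t → sumReps λ u →
      if does (E? (t ⊕ u) s) then f t * g u else 0#

    _−_ : Elt → Elt → Elt
    (f − g) s = f s + (- g s)

    scale : Carrier → Elt → Elt
    scale a f s = a * f s

    IsZero : Elt → Set ℓ
    IsZero f = ∀ s → P s → f s ≈ 0#

    prodFin : ∀ {m} → (Fin (suc m) → Elt) → Elt
    prodFin {zero} f = f fzero
    prodFin {suc m} f = f fzero · prodFin (λ i → f (fsuc i))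

    IsIdemOf : Fin size → Fin size → Set
    IsIdemOf s e = P e × E (e ⊕ e) e × ∃ λ m → E e (mulSuc m s)

    Good : ∀ {m} → (Fin (suc m) → Fin size) → Set (c ⊔ ℓ)
    Good {m} s = (∀ i → P (s i))
      × (∀ (a : Fin (suc m) → Carrier) → (∀ i → ¬ (a i ≈ 0#))
         → ∀ (e : Fin (suc m) → Fin size) → (∀ i → IsIdemOf (s i) (e i))
         → ¬ IsZero (prodFin (λ i → X^ (s i) − scale (a i) (X^ (e i)))))

    -- k is an upper bound for d(T, K) (the supremum of admissible lengths)
    DUpper : ℕ → Set (c ⊔ ℓ)
    DUpper k = ∀ m (s : Fin (suc m) → Fin size) → Good s → suc m ≤ k

{-# OPTIONS --safe #-}
module Submission where

-- In a Clifford semigroup the idempotent e(a) = a + a⁻¹ satisfies e(x + y) = e(x) + e(y), and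
-- H_a = {x : e(x) = e(a)}: so H_a is a group with identity e(a), it contains every subgroup through a,
-- ⟨a⟩ is a group, and c ↦ c + e(a) identifies Γ(H_a) with H_a.
--
-- For d, a homomorphism ψ between presented semigroups extends to a multiplicative map of semigroup
-- rings, so good sequences are reflected along ψ and, when ψ is injective, preserved; this compares S
-- with Γ(H_a) (via c ↦ c + e(a)) and with its subgroups (via inclusion). Conversely, for a sequence s
-- of S put f = e(s₁) + ⋯ + e(sₙ), an idempotent above every e(sᵢ). Then
--   ∏ (X^{sᵢ} − aᵢ X^{e(sᵢ)}) = X^f ∏ (X^{sᵢ} − aᵢ X^{e(sᵢ)}) = ∏ (X^{sᵢ+f} − aᵢ X^f),
-- and e(sᵢ + f) = f, so a good sequence s of S gives the good sequence (sᵢ + f) in the group H_f.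
-- None of this uses the hypothesis on K.

open import Defs
open import Level using (Level; 0ℓ)
open import Algebra.Bundles using (CommutativeRing; CommutativeSemigroup)
open import Algebra.Structures using (IsCommutativeSemigroup)
import Algebra.Properties.CommutativeSemigroup as CommSemigroupProperties
import Algebra.Properties.Ring as RingProperties
open import Data.Bool using (if_then_else_)
open import Data.Nat using (ℕ; zero; suc; _^_) renaming (_+_ to _+ℕ_)
open import Data.Nat.Properties using (m≤n⇒∃[o]m+o≡n; n<1+n)
open import Data.Nat.Primality using (Prime)
open import Data.Fin using (Fin; zero; suc; _<_; fromℕ<; toℕ)
open import Data.Fin.Properties
  using (_≟_; _<?_; any?; <-cmp; suc-injective; ¬∀⟶∃¬-smallest; toℕ-injective; toℕ-inject; toℕ-fromℕ<; pigeonhole)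
open import Data.Fin.Subset using (Subset; _∈_)
open import Data.Fin.Subset.Properties using (_∈?_)
open import Data.List using (List; []; _∷_; foldr; filter; tabulate)
open import Data.List.Relation.Unary.All using (All; []; _∷_)
import Data.List.Relation.Unary.All as All
open import Data.List.Relation.Unary.All.Properties using (all-filter; tabulate⁺)
open import Data.Product using (∃; _×_; _,_; proj₁; proj₂)
open import Data.Sum using (_⊎_; inj₁; inj₂)
open import Data.Unit using (⊤; tt)
import Data.Vec as Vec
open import Data.Vec.Properties using (lookup∘tabulate; []=⇒lookup; lookup⇒[]=)
open import Function using (id; _∘_)
open import Function.Bundles using (_⇔_; mk⇔)
open import Relation.Binary using (IsEquivalence; tri<; tri≈; tri>)
open import Relation.Binary.PropositionalEquality as ≡ using (_≡_)
import Relation.Binary.Reasoning.Setoid as SetoidReasoning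
open import Relation.Nullary using (Dec; yes; no; does; ¬_)
open import Relation.Nullary.Decidable using (¬?; _×-dec_; decidable-stable; dec-true; dec-false)
open import Relation.Nullary.Negation using (contradiction)

-- Sums are folded exactly like `sumReps` in Defs, so that the two agree definitionally.
module ListSum {c ℓ} (R : CommutativeRing c ℓ) where
  open CommutativeRing R hiding (zero)
  open RingProperties ring using (-0#≈0#; -‿+-comm)
  open CommSemigroupProperties +-commutativeSemigroup using (interchange)
  open SetoidReasoning setoid

  private
    variable
      p q : Level
      A B C D : Set
      P : Set p
      Q : Set q

  ∑ : List A → (A → Carrier) → Carrier
  ∑ L f = foldr (λ i acc → f i + acc) 0# L

  infix 5 ∑
  syntax ∑ L (λ i → e) = ∑[ i ∈ L ] e

  ∑-congᴬ : ∀ {Q : A → Set q} {L} → All Q L → {f g : A → Carrier}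
          → (∀ {i} → Q i → f i ≈ g i) → ∑ L f ≈ ∑ L g
  ∑-congᴬ []       f≈g = refl
  ∑-congᴬ (q ∷ qs) f≈g = +-cong (f≈g q) (∑-congᴬ qs f≈g)

  ∑-cong : ∀ (L : List A) {f g : A → Carrier} → (∀ i → f i ≈ g i) → ∑ L f ≈ ∑ L g
  ∑-cong []      f≈g = refl
  ∑-cong (x ∷ L) f≈g = +-cong (f≈g x) (∑-cong L f≈g)

  ∑-zeroᴬ : ∀ {Q : A → Set q} {L} → All Q L → {f : A → Carrier}
          → (∀ {i} → Q i → f i ≈ 0#) → ∑ L f ≈ 0#
  ∑-zeroᴬ []       f≈0 = refl
  ∑-zeroᴬ (q ∷ qs) f≈0 = trans (+-cong (f≈0 q) (∑-zeroᴬ qs f≈0)) (+-identityˡ 0#)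

  ∑-zero : ∀ (L : List A) → ∑[ i ∈ L ] 0# ≈ 0#
  ∑-zero []      = refl
  ∑-zero (x ∷ L) = trans (+-congˡ (∑-zero L)) (+-identityˡ 0#)

  ∑-distrib-+ : ∀ (L : List A) f g → ∑[ i ∈ L ] (f i + g i) ≈ ∑ L f + ∑ L g
  ∑-distrib-+ []      f g = sym (+-identityˡ 0#)
  ∑-distrib-+ (x ∷ L) f g = trans (+-congˡ (∑-distrib-+ L f g)) (interchange (f x) (g x) _ _)

  *-distribˡ-∑ : ∀ (L : List A) a f → a * ∑ L f ≈ ∑[ i ∈ L ] (a * f i)
  *-distribˡ-∑ []      a f = zeroʳ a
  *-distribˡ-∑ (x ∷ L) a f = trans (distribˡ a (f x) (∑ L f)) (+-congˡ (*-distribˡ-∑ L a f))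

  *-distribʳ-∑ : ∀ (L : List A) a f → ∑ L f * a ≈ ∑[ i ∈ L ] (f i * a)
  *-distribʳ-∑ L a f = trans (*-comm _ a) (trans (*-distribˡ-∑ L a f) (∑-cong L (λ i → *-comm a (f i))))

  -‿distrib-∑ : ∀ (L : List A) f → - ∑ L f ≈ ∑[ i ∈ L ] (- f i)
  -‿distrib-∑ []      f = -0#≈0#
  -‿distrib-∑ (x ∷ L) f = trans (sym (-‿+-comm (f x) (∑ L f))) (+-congˡ (-‿distrib-∑ L f))

  ∑-linear : ∀ (L : List A) a f g → ∑[ i ∈ L ] (f i + - (a * g i)) ≈ ∑ L f + - (a * ∑ L g)
  ∑-linear L a f g = begin
    ∑[ i ∈ L ] (f i + - (a * g i))     ≈⟨ ∑-distrib-+ L f _ ⟩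
    ∑ L f + (∑[ i ∈ L ] - (a * g i))   ≈⟨ +-congˡ (-‿distrib-∑ L _) ⟨
    ∑ L f + - (∑[ i ∈ L ] a * g i)     ≈⟨ +-congˡ (-‿cong (*-distribˡ-∑ L a g)) ⟨
    ∑ L f + - (a * ∑ L g)              ∎

  ∑-*-∑ : ∀ (L : List A) (M : List B) f g → ∑ L f * ∑ M g ≈ ∑[ i ∈ L ] ∑[ j ∈ M ] (f i * g j)
  ∑-*-∑ L M f g = trans (*-distribʳ-∑ L (∑ M g) f) (∑-cong L (λ i → *-distribˡ-∑ M (f i) g))

  ∑-comm : ∀ (L : List A) (M : List B) (f : A → B → Carrier)
         → ∑[ i ∈ L ] ∑[ j ∈ M ] f i j ≈ ∑[ j ∈ M ] ∑[ i ∈ L ] f i j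
  ∑-comm []      M f = sym (∑-zero M)
  ∑-comm (x ∷ L) M f = begin
    ∑ M (f x) + (∑[ i ∈ L ] ∑ M (f i))          ≈⟨ +-congˡ (∑-comm L M f) ⟩
    ∑ M (f x) + (∑[ j ∈ M ] ∑[ i ∈ L ] f i j)   ≈⟨ ∑-distrib-+ M (f x) _ ⟨
    ∑[ j ∈ M ] (f x j + (∑[ i ∈ L ] f i j))     ∎

  ∑∑-comm : ∀ (L : List A) (M : List B) (N : List C) (O : List D) (f : A → B → C → D → Carrier)
          → ∑[ i ∈ L ] ∑[ j ∈ M ] ∑[ k ∈ N ] ∑[ l ∈ O ] f i j k l
          ≈ ∑[ k ∈ N ] ∑[ l ∈ O ] ∑[ i ∈ L ] ∑[ j ∈ M ] f i j k l
  ∑∑-comm L M N O f = begin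
    ∑[ i ∈ L ] ∑[ j ∈ M ] ∑[ k ∈ N ] ∑[ l ∈ O ] f i j k l ≈⟨ ∑-cong L (λ i → ∑-comm M N _) ⟩
    ∑[ i ∈ L ] ∑[ k ∈ N ] ∑[ j ∈ M ] ∑[ l ∈ O ] f i j k l ≈⟨ ∑-comm L N _ ⟩
    ∑[ k ∈ N ] ∑[ i ∈ L ] ∑[ j ∈ M ] ∑[ l ∈ O ] f i j k l ≈⟨ ∑-cong N (λ k → ∑-cong L (λ i → ∑-comm M O _)) ⟩
    ∑[ k ∈ N ] ∑[ i ∈ L ] ∑[ l ∈ O ] ∑[ j ∈ M ] f i j k l ≈⟨ ∑-cong N (λ k → ∑-comm L O _) ⟩
    ∑[ k ∈ N ] ∑[ l ∈ O ] ∑[ i ∈ L ] ∑[ j ∈ M ] f i j k l ∎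

  when : Dec P → Carrier → Carrier
  when d x = if does d then x else 0#

  when-cong : ∀ (d : Dec P) {x y} → x ≈ y → when d x ≈ when d y
  when-cong (yes _) x≈y = x≈y
  when-cong (no _)  x≈y = refl

  when-yes : ∀ (d : Dec P) {x} → P → when d x ≈ x
  when-yes (yes _)  _ = refl
  when-yes (no ¬p) p = contradiction p ¬p

  when-no : ∀ (d : Dec P) {x} → ¬ P → when d x ≈ 0#
  when-no (yes p) ¬p = contradiction p ¬p
  when-no (no _)  _  = refl

  when-zero : ∀ (d : Dec P) → when d 0# ≈ 0#
  when-zero (yes _) = refl
  when-zero (no _)  = refl

  when-⇔ : ∀ (d : Dec P) (e : Dec Q) {x} → (P → Q) → (Q → P) → when d x ≈ when e x
  when-⇔ (yes p) (yes q) _ _ = refl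
  when-⇔ (yes p) (no ¬q) f _ = contradiction (f p) ¬q
  when-⇔ (no ¬p) (yes q) _ g = contradiction (g q) ¬p
  when-⇔ (no _)  (no _)  _ _ = refl

  when-comm : ∀ (d : Dec P) (e : Dec Q) x → when d (when e x) ≈ when e (when d x)
  when-comm (yes _) (yes _) x = refl
  when-comm (yes _) (no _)  x = refl
  when-comm (no _)  (yes _) x = refl
  when-comm (no _)  (no _)  x = refl

  when-*ˡ : ∀ (d : Dec P) a x → a * when d x ≈ when d (a * x)
  when-*ˡ (yes _) a x = refl
  when-*ˡ (no _)  a x = zeroʳ a

  when-*ʳ : ∀ (d : Dec P) a x → when d x * a ≈ when d (x * a)
  when-*ʳ (yes _) a x = refl
  when-*ʳ (no _)  a x = zeroˡ a

  when-+ : ∀ (d : Dec P) x y → when d (x + y) ≈ when d x + when d y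
  when-+ (yes _) x y = refl
  when-+ (no _)  x y = sym (+-identityˡ 0#)

  when-neg : ∀ (d : Dec P) x → when d (- x) ≈ - when d x
  when-neg (yes _) x = refl
  when-neg (no _)  x = sym -0#≈0#

  when-∑ : ∀ (d : Dec P) (L : List A) f → when d (∑ L f) ≈ ∑[ i ∈ L ] when d (f i)
  when-∑ (yes _) L f = refl
  when-∑ (no _)  L f = sym (∑-zero L)

  when-∑∑ : ∀ (d : Dec P) (L : List A) (M : List B) (f : A → B → Carrier)
          → when d (∑[ i ∈ L ] ∑[ j ∈ M ] f i j) ≈ ∑[ i ∈ L ] ∑[ j ∈ M ] when d (f i j)
  when-∑∑ d L M f = trans (when-∑ d L _) (∑-cong L (λ i → when-∑ d M (f i)))

  ∑-filter : ∀ {Q : A → Set} (Q? : ∀ i → Dec (Q i)) L f → ∑ (filter Q? L) f ≈ ∑[ i ∈ L ] when (Q? i) (f i)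
  ∑-filter Q? []      f = refl
  ∑-filter Q? (x ∷ L) f with Q? x
  ... | yes _ = +-congˡ (∑-filter Q? L f)
  ... | no _  = trans (∑-filter Q? L f) (sym (+-identityˡ _))

  ∑-tabulate-δ : ∀ {n} (g : Fin n → A) j a {f} → (∀ i → f (g i) ≈ when (i ≟ j) a) → ∑ (tabulate g) f ≈ a
  ∑-tabulate-δ g zero a {f} f∘g≈δ = begin
    f (g zero) + ∑ (tabulate (g ∘ suc)) f  ≈⟨ +-cong (f∘g≈δ zero) rest≈0 ⟩
    a + 0#                                 ≈⟨ +-identityʳ a ⟩
    a                                      ∎
    where
    rest≈0 : ∑ (tabulate (g ∘ suc)) f ≈ 0#
    rest≈0 = ∑-zeroᴬ (tabulate⁺ (λ i → trans (f∘g≈δ (suc i)) (when-no (suc i ≟ zero) {a} λ ()))) id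
  ∑-tabulate-δ g (suc j) a {f} f∘g≈δ = begin
    f (g zero) + ∑ (tabulate (g ∘ suc)) f  ≈⟨ +-cong (trans (f∘g≈δ zero) (when-no (zero ≟ suc j) {a} λ ())) rest≈a ⟩
    0# + a                                 ≈⟨ +-identityˡ a ⟩
    a                                      ∎
    where
    rest≈a : ∑ (tabulate (g ∘ suc)) f ≈ a
    rest≈a = ∑-tabulate-δ (g ∘ suc) j a
      (λ i → trans (f∘g≈δ (suc i)) (when-⇔ (suc i ≟ suc j) (i ≟ j) suc-injective (≡.cong suc)))

∃-least : ∀ {n} {Q : Fin n → Set} → (∀ i → Dec (Q i)) → ∀ {x} → Q x
        → ∃ λ j → Q j × (∀ k → k < j → ¬ Q k)
∃-least {n} {Q} Q? {x} qx with ¬∀⟶∃¬-smallest n (¬_ ∘ Q) (¬? ∘ Q?) (λ ∀¬Q → ∀¬Q x qx)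
... | j , ¬¬qj , below = j , decidable-stable (Q? j) ¬¬qj , least
  where
  least : ∀ k → k < j → ¬ Q k
  least k k<j = ≡.subst (¬_ ∘ Q) (toℕ-injective (≡.trans (toℕ-inject _) (toℕ-fromℕ< k<j))) (below (fromℕ< k<j))

record Subquotient (S : FinCommSemigroup) : Set₁ where
  open FinCommSemigroup S
  field
    P               : Fin size → Set
    P?              : ∀ x → Dec (P x)
    E               : Fin size → Fin size → Set
    E?              : ∀ x y → Dec (E x y)
    E-isEquivalence : IsEquivalence E
    P-⊕             : ∀ {x y} → P x → P y → P (x ⊕ y)
    E-⊕ʳ            : ∀ {x y u} → P x → P y → P u → E x y → E (x ⊕ u) (y ⊕ u)

  open IsEquivalence E-isEquivalence public using () renaming (refl to E-refl; sym to E-sym; trans to E-trans)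

  E-⊕ˡ : ∀ {x y u} → P x → P y → P u → E x y → E (u ⊕ x) (u ⊕ y)
  E-⊕ˡ {x} {y} {u} px py pu x~y = ≡.subst₂ E (comm x u) (comm y u) (E-⊕ʳ px py pu x~y)

  P-mulSuc : ∀ m {x} → P x → P (mulSuc S m x)
  P-mulSuc zero    px = px
  P-mulSuc (suc m) px = P-⊕ px (P-mulSuc m px)

  E-mulSuc : ∀ m {x y} → P x → P y → E x y → E (mulSuc S m x) (mulSuc S m y)
  E-mulSuc zero    px py x~y = x~y
  E-mulSuc (suc m) px py x~y =
    E-trans (E-⊕ʳ px py (P-mulSuc m px) x~y) (E-⊕ˡ (P-mulSuc m px) (P-mulSuc m py) py (E-mulSuc m px py x~y))

module _ (S : FinCommSemigroup) where
  open FinCommSemigroup S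

  whole : Subquotient S
  whole = record
    { P = λ _ → ⊤ ; P? = λ _ → yes tt ; E = _≡_ ; E? = _≟_ ; E-isEquivalence = ≡.isEquivalence
    ; P-⊕ = λ _ _ → tt ; E-⊕ʳ = λ {_} {_} {u} _ _ _ → ≡.cong (_⊕ u) }

  subgroup : (T : Subset size) → IsSubgroup S (_∈ T) → Subquotient S
  subgroup T T-isSubgroup = record
    { P = _∈ T ; P? = _∈? T ; E = _≡_ ; E? = _≟_ ; E-isEquivalence = ≡.isEquivalence
    ; P-⊕ = proj₁ T-isSubgroup _ _ ; E-⊕ʳ = λ {_} {_} {u} _ _ _ → ≡.cong (_⊕ u) }

  schützenberger : Fin size → Subquotient S
  schützenberger a = record
    { P = St S a ; P? = St? S a ; E = γEq S a ; E? = γEq? S a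
    ; E-isEquivalence = record
      { refl  = λ _ _ → ≡.refl
      ; sym   = λ γc≡γd x x∈Ha → ≡.sym (γc≡γd x x∈Ha)
      ; trans = λ γc≡γd γd≡γe x x∈Ha → ≡.trans (γc≡γd x x∈Ha) (γd≡γe x x∈Ha)
      }
    ; P-⊕ = λ {c} {d} c∈St d∈St x x∈Ha → ≡.subst (H S a) (≡.sym (assoc c d x)) (c∈St (d ⊕ x) (d∈St x x∈Ha))
    ; E-⊕ʳ = λ {c} {d} {u} _ _ u∈St γc≡γd x x∈Ha →
        ≡.trans (assoc c u x) (≡.trans (γc≡γd (u ⊕ x) (u∈St x x∈Ha)) (≡.sym (assoc d u x)))
    }

module SemigroupRing (S : FinCommSemigroup) {c ℓ : Level} (K : Field c ℓ) (T : Subquotient S) where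
  open FinCommSemigroup S renaming (assoc to ⊕-assoc; comm to ⊕-comm)
  open Subquotient T public
  open Field K hiding (zero)
  open ListSum commutativeRing
  open RingProperties ring using (-‿distribʳ-*)
  open CommSemigroupProperties *-commutativeSemigroup using (x∙yz≈y∙xz)
  open DInv S K P P? E E? public
  open SetoidReasoning setoid

  reps⊆P : All P reps
  reps⊆P = All.map proj₁ (all-filter _ (tabulate id))

  Invariant : (Fin size → Carrier) → Set ℓ
  Invariant g = ∀ {r r'} → P r → P r' → E r r' → g r ≈ g r'

  -- `reps` keeps the least element of each E-class of P, so exactly one term survives.
  ∑-δ : ∀ {x} → P x → ∀ g → Invariant g → ∑[ r ∈ reps ] when (E? r x) (g r) ≈ g x
  ∑-δ {x} px g g-inv with ∃-least (λ j → P? j ×-dec E? j x) (px , E-refl)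
  ... | j , (pj , j~x) , j-least = begin
    ∑[ r ∈ reps ] when (E? r x) (g r)                          ≈⟨ ∑-filter IsRep? (tabulate id) _ ⟩
    ∑[ i ∈ tabulate id ] when (IsRep? i) (when (E? i x) (g i)) ≈⟨ ∑-tabulate-δ id j (g x) δ ⟩
    g x                                                        ∎
    where
    IsRep : Fin size → Set
    IsRep i = P i × ¬ (∃ λ k → k < i × (P k × E k i))
    IsRep? : ∀ i → Dec (IsRep i)
    IsRep? i = P? i ×-dec ¬? (any? (λ k → (k <? i) ×-dec (P? k ×-dec E? k i)))
    j-isRep : IsRep j
    j-isRep = pj , λ (k , k<j , pk , k~j) → j-least k k<j (pk , E-trans k~j j~x)
    unique-rep : ∀ {i} → IsRep i → E i x → i ≡ j
    unique-rep {i} (pi , i-rep) i~x with <-cmp i j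
    ... | tri< i<j _ _ = contradiction (pi , i~x) (j-least i i<j)
    ... | tri≈ _ i≡j _ = i≡j
    ... | tri> _ _ j<i = contradiction (j , j<i , pj , E-trans j~x (E-sym i~x)) i-rep
    δ : ∀ i → when (IsRep? i) (when (E? i x) (g i)) ≈ when (i ≟ j) (g x)
    δ i with i ≟ j
    ... | yes ≡.refl = trans (when-yes (IsRep? i) j-isRep) (trans (when-yes (E? i x) j~x) (g-inv pj px j~x))
    ... | no i≢j with E? i x
    ...   | yes i~x = when-no (IsRep? i) (λ i-rep → i≢j (unique-rep i-rep i~x))
    ...   | no _    = when-zero (IsRep? i)

  ∑-δ′ : ∀ {x} → P x → ∀ g → Invariant g → ∑[ r ∈ reps ] when (E? x r) (g r) ≈ g x
  ∑-δ′ px g g-inv = trans (∑-congᴬ reps⊆P (λ _ → when-⇔ (E? _ _) (E? _ _) E-sym E-sym)) (∑-δ px g g-inv)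

  ∑ᴿ-cong : ∀ {f g : Fin size → Carrier} → (∀ {t} → P t → f t ≈ g t) → ∑ reps f ≈ ∑ reps g
  ∑ᴿ-cong = ∑-congᴬ reps⊆P

  when-E-⊕ʳ-invariant : ∀ {w} x z → P w → Invariant (λ r → when (E? (r ⊕ w) x) z)
  when-E-⊕ʳ-invariant x z pw pr pr' r~r' =
    when-⇔ (E? _ x) (E? _ x) (E-trans (E-⊕ʳ pr' pr pw (E-sym r~r'))) (E-trans (E-⊕ʳ pr pr' pw r~r'))

  when-E-⊕ˡ-invariant : ∀ {w} x z → P w → Invariant (λ r → when (E? (w ⊕ r) x) z)
  when-E-⊕ˡ-invariant x z pw pr pr' r~r' =
    when-⇔ (E? _ x) (E? _ x) (E-trans (E-⊕ˡ pr' pr pw (E-sym r~r'))) (E-trans (E-⊕ˡ pr pr' pw r~r'))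

  when-E-≡ : ∀ {a b} x z → a ≡ b → when (E? a x) z ≈ when (E? b x) z
  when-E-≡ x z ≡.refl = refl

  infix 4 _≋_
  _≋_ : Elt → Elt → Set ℓ
  f ≋ g = ∀ x → P x → f x ≈ g x

  ≋-isEquivalence : IsEquivalence _≋_
  ≋-isEquivalence = record
    { refl  = λ x _ → refl
    ; sym   = λ f≋g x px → sym (f≋g x px)
    ; trans = λ f≋g g≋h x px → trans (f≋g x px) (g≋h x px)
    }

  open IsEquivalence ≋-isEquivalence public using () renaming (refl to ≋-refl; sym to ≋-sym; trans to ≋-trans)

  ·-cong : ∀ {f f' g g'} → f ≋ f' → g ≋ g' → f · g ≋ f' · g'
  ·-cong f≋f' g≋g' x _ = ∑ᴿ-cong λ pt → ∑ᴿ-cong λ pu → when-cong (E? _ x) (*-cong (f≋f' _ pt) (g≋g' _ pu))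

  ·-comm : ∀ f g → f · g ≋ g · f
  ·-comm f g x _ = trans (∑-comm reps reps _) (∑-cong reps λ u → ∑-cong reps λ t →
    trans (when-E-≡ x _ (⊕-comm t u)) (when-cong (E? (u ⊕ t) x) (*-comm (f t) (g u))))

  ·-expandˡ : ∀ f g h x → ((f · g) · h) x
            ≈ ∑[ w ∈ reps ] ∑[ t ∈ reps ] ∑[ u ∈ reps ] when (E? ((t ⊕ u) ⊕ w) x) ((f t * g u) * h w)
  ·-expandˡ f g h x = begin
    ∑[ v ∈ reps ] ∑[ w ∈ reps ] when (E? (v ⊕ w) x) ((f · g) v * h w)
      ≈⟨ ∑-cong reps (λ v → ∑-cong reps (distribute v)) ⟩
    ∑[ v ∈ reps ] ∑[ w ∈ reps ] ∑[ t ∈ reps ] ∑[ u ∈ reps ] when (E? (t ⊕ u) v) (when (E? (v ⊕ w) x) (F t u w))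
      ≈⟨ trans (∑-comm reps reps _)
               (∑-cong reps (λ w → trans (∑-comm reps reps _) (∑-cong reps (λ t → ∑-comm reps reps _)))) ⟩
    ∑[ w ∈ reps ] ∑[ t ∈ reps ] ∑[ u ∈ reps ] ∑[ v ∈ reps ] when (E? (t ⊕ u) v) (when (E? (v ⊕ w) x) (F t u w))
      ≈⟨ ∑ᴿ-cong (λ pw → ∑ᴿ-cong (λ pt → ∑ᴿ-cong (λ pu →
           ∑-δ′ (P-⊕ pt pu) _ (when-E-⊕ʳ-invariant x _ pw)))) ⟩
    ∑[ w ∈ reps ] ∑[ t ∈ reps ] ∑[ u ∈ reps ] when (E? ((t ⊕ u) ⊕ w) x) (F t u w) ∎
    where
    F : Fin size → Fin size → Fin size → Carrier
    F t u w = (f t * g u) * h w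
    distribute : ∀ v w → when (E? (v ⊕ w) x) ((f · g) v * h w)
               ≈ ∑[ t ∈ reps ] ∑[ u ∈ reps ] when (E? (t ⊕ u) v) (when (E? (v ⊕ w) x) (F t u w))
    distribute v w = begin
      when (E? (v ⊕ w) x) ((f · g) v * h w)
        ≈⟨ when-cong (E? (v ⊕ w) x)
             (trans (*-distribʳ-∑ reps (h w) _) (∑-cong reps (λ t → *-distribʳ-∑ reps (h w) _))) ⟩
      when (E? (v ⊕ w) x) (∑[ t ∈ reps ] ∑[ u ∈ reps ] (when (E? (t ⊕ u) v) (f t * g u) * h w))
        ≈⟨ when-∑∑ (E? (v ⊕ w) x) reps reps _ ⟩
      ∑[ t ∈ reps ] ∑[ u ∈ reps ] when (E? (v ⊕ w) x) (when (E? (t ⊕ u) v) (f t * g u) * h w)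
        ≈⟨ ∑-cong reps (λ t → ∑-cong reps (λ u → trans (when-cong (E? (v ⊕ w) x) (when-*ʳ (E? (t ⊕ u) v) (h w) _))
                                                       (when-comm (E? (v ⊕ w) x) (E? (t ⊕ u) v) _))) ⟩
      ∑[ t ∈ reps ] ∑[ u ∈ reps ] when (E? (t ⊕ u) v) (when (E? (v ⊕ w) x) (F t u w)) ∎

  ·-expandʳ : ∀ f g h x → (f · (g · h)) x
            ≈ ∑[ t ∈ reps ] ∑[ u ∈ reps ] ∑[ w ∈ reps ] when (E? (t ⊕ (u ⊕ w)) x) (f t * (g u * h w))
  ·-expandʳ f g h x = begin
    ∑[ t ∈ reps ] ∑[ y ∈ reps ] when (E? (t ⊕ y) x) (f t * (g · h) y)
      ≈⟨ ∑-cong reps (λ t → ∑-cong reps (distribute t)) ⟩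
    ∑[ t ∈ reps ] ∑[ y ∈ reps ] ∑[ u ∈ reps ] ∑[ w ∈ reps ] when (E? (u ⊕ w) y) (when (E? (t ⊕ y) x) (F t u w))
      ≈⟨ ∑-cong reps (λ t → trans (∑-comm reps reps _) (∑-cong reps (λ u → ∑-comm reps reps _))) ⟩
    ∑[ t ∈ reps ] ∑[ u ∈ reps ] ∑[ w ∈ reps ] ∑[ y ∈ reps ] when (E? (u ⊕ w) y) (when (E? (t ⊕ y) x) (F t u w))
      ≈⟨ ∑ᴿ-cong (λ pt → ∑ᴿ-cong (λ pu → ∑ᴿ-cong (λ pw →
           ∑-δ′ (P-⊕ pu pw) _ (when-E-⊕ˡ-invariant x _ pt)))) ⟩
    ∑[ t ∈ reps ] ∑[ u ∈ reps ] ∑[ w ∈ reps ] when (E? (t ⊕ (u ⊕ w)) x) (F t u w) ∎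
    where
    F : Fin size → Fin size → Fin size → Carrier
    F t u w = f t * (g u * h w)
    distribute : ∀ t y → when (E? (t ⊕ y) x) (f t * (g · h) y)
               ≈ ∑[ u ∈ reps ] ∑[ w ∈ reps ] when (E? (u ⊕ w) y) (when (E? (t ⊕ y) x) (F t u w))
    distribute t y = begin
      when (E? (t ⊕ y) x) (f t * (g · h) y)
        ≈⟨ when-cong (E? (t ⊕ y) x)
             (trans (*-distribˡ-∑ reps (f t) _) (∑-cong reps (λ u → *-distribˡ-∑ reps (f t) _))) ⟩
      when (E? (t ⊕ y) x) (∑[ u ∈ reps ] ∑[ w ∈ reps ] (f t * when (E? (u ⊕ w) y) (g u * h w)))
        ≈⟨ when-∑∑ (E? (t ⊕ y) x) reps reps _ ⟩
      ∑[ u ∈ reps ] ∑[ w ∈ reps ] when (E? (t ⊕ y) x) (f t * when (E? (u ⊕ w) y) (g u * h w))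
        ≈⟨ ∑-cong reps (λ u → ∑-cong reps (λ w → trans (when-cong (E? (t ⊕ y) x) (when-*ˡ (E? (u ⊕ w) y) (f t) _))
                                                       (when-comm (E? (t ⊕ y) x) (E? (u ⊕ w) y) _))) ⟩
      ∑[ u ∈ reps ] ∑[ w ∈ reps ] when (E? (u ⊕ w) y) (when (E? (t ⊕ y) x) (F t u w)) ∎

  ·-assoc : ∀ f g h → (f · g) · h ≋ f · (g · h)
  ·-assoc f g h x _ = begin
    ((f · g) · h) x
      ≈⟨ ·-expandˡ f g h x ⟩
    ∑[ w ∈ reps ] ∑[ t ∈ reps ] ∑[ u ∈ reps ] when (E? ((t ⊕ u) ⊕ w) x) ((f t * g u) * h w)
      ≈⟨ ∑-cong reps (λ w → ∑-cong reps (λ t → ∑-cong reps (λ u →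
           trans (when-E-≡ x _ (⊕-assoc t u w)) (when-cong (E? _ x) (*-assoc (f t) (g u) (h w)))))) ⟩
    ∑[ w ∈ reps ] ∑[ t ∈ reps ] ∑[ u ∈ reps ] when (E? (t ⊕ (u ⊕ w)) x) (f t * (g u * h w))
      ≈⟨ trans (∑-comm reps reps _) (∑-cong reps (λ t → ∑-comm reps reps _)) ⟩
    ∑[ t ∈ reps ] ∑[ u ∈ reps ] ∑[ w ∈ reps ] when (E? (t ⊕ (u ⊕ w)) x) (f t * (g u * h w))
      ≈⟨ ·-expandʳ f g h x ⟨
    (f · (g · h)) x ∎

  ·-isCommutativeSemigroup : IsCommutativeSemigroup _≋_ _·_
  ·-isCommutativeSemigroup = record
    { isSemigroup = record
      { isMagma = record { isEquivalence = ≋-isEquivalence ; ∙-cong = ·-cong }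
      ; assoc   = ·-assoc
      }
    ; comm = ·-comm
    }

  ·-commutativeSemigroup : CommutativeSemigroup c ℓ
  ·-commutativeSemigroup = record { isCommutativeSemigroup = ·-isCommutativeSemigroup }

  X^-· : ∀ {a b} → P a → P b → X^ a · X^ b ≋ X^ (a ⊕ b)
  X^-· {a} {b} pa pb x _ = begin
    ∑[ t ∈ reps ] ∑[ u ∈ reps ] when (E? (t ⊕ u) x) (X^ a t * X^ b u)
      ≈⟨ ∑-cong reps (λ t → ∑-cong reps (λ u → separate t u)) ⟩
    ∑[ t ∈ reps ] ∑[ u ∈ reps ] when (E? t a) (when (E? u b) (when (E? (t ⊕ u) x) 1#))
      ≈⟨ ∑ᴿ-cong (λ pt → trans (sym (when-∑ (E? _ a) reps _))
                               (when-cong (E? _ a) (∑-δ pb _ (when-E-⊕ˡ-invariant x 1# pt)))) ⟩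
    ∑[ t ∈ reps ] when (E? t a) (when (E? (t ⊕ b) x) 1#)
      ≈⟨ ∑-δ pa _ (when-E-⊕ʳ-invariant x 1# pb) ⟩
    when (E? (a ⊕ b) x) 1#
      ≈⟨ when-⇔ (E? (a ⊕ b) x) (E? x (a ⊕ b)) E-sym E-sym ⟩
    X^ (a ⊕ b) x ∎
    where
    separate : ∀ t u → when (E? (t ⊕ u) x) (X^ a t * X^ b u)
                     ≈ when (E? t a) (when (E? u b) (when (E? (t ⊕ u) x) 1#))
    separate t u = begin
      when (E? (t ⊕ u) x) (when (E? t a) 1# * when (E? u b) 1#)
        ≈⟨ when-cong (E? (t ⊕ u) x) (trans (when-*ʳ (E? t a) _ 1#) (when-cong (E? t a) (*-identityˡ _))) ⟩
      when (E? (t ⊕ u) x) (when (E? t a) (when (E? u b) 1#))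
        ≈⟨ trans (when-comm (E? (t ⊕ u) x) (E? t a) _)
                 (when-cong (E? t a) (when-comm (E? (t ⊕ u) x) (E? u b) 1#)) ⟩
      when (E? t a) (when (E? u b) (when (E? (t ⊕ u) x) 1#)) ∎

  ·-distribˡ-− : ∀ f g h a → f · (g − scale a h) ≋ (f · g) − scale a (f · h)
  ·-distribˡ-− f g h a x _ = begin
    ∑[ t ∈ reps ] ∑[ y ∈ reps ] when (E? (t ⊕ y) x) (f t * (g y + - (a * h y)))
      ≈⟨ ∑-cong reps (λ t → ∑-cong reps (λ y → expand t y)) ⟩
    ∑[ t ∈ reps ] ∑[ y ∈ reps ] (when (E? (t ⊕ y) x) (f t * g y) + - (a * when (E? (t ⊕ y) x) (f t * h y)))
      ≈⟨ ∑-cong reps (λ t → ∑-linear reps a _ _) ⟩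
    ∑[ t ∈ reps ] (∑[ y ∈ reps ] when (E? (t ⊕ y) x) (f t * g y))
                   + - (a * (∑[ y ∈ reps ] when (E? (t ⊕ y) x) (f t * h y)))
      ≈⟨ ∑-linear reps a _ _ ⟩
    ((f · g) − scale a (f · h)) x ∎
    where
    expand : ∀ t y → when (E? (t ⊕ y) x) (f t * (g y + - (a * h y)))
           ≈ when (E? (t ⊕ y) x) (f t * g y) + - (a * when (E? (t ⊕ y) x) (f t * h y))
    expand t y = begin
      when (E? (t ⊕ y) x) (f t * (g y + - (a * h y)))
        ≈⟨ when-cong (E? (t ⊕ y) x) (trans (distribˡ (f t) (g y) _)
             (+-congˡ (trans (sym (-‿distribʳ-* (f t) _)) (-‿cong (x∙yz≈y∙xz (f t) a (h y)))))) ⟩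
      when (E? (t ⊕ y) x) (f t * g y + - (a * (f t * h y)))
        ≈⟨ trans (when-+ (E? (t ⊕ y) x) _ _) (+-congˡ (trans (when-neg (E? (t ⊕ y) x) _)
             (-‿cong (sym (when-*ˡ (E? (t ⊕ y) x) a _))))) ⟩
      when (E? (t ⊕ y) x) (f t * g y) + - (a * when (E? (t ⊕ y) x) (f t * h y)) ∎

  X^-cong : ∀ {s s'} → E s s' → X^ s ≋ X^ s'
  X^-cong s~s' t _ = when-⇔ (E? t _) (E? t _) (λ t~s → E-trans t~s s~s') (λ t~s' → E-trans t~s' (E-sym s~s'))

  binomial : Fin size → Carrier → Fin size → Elt
  binomial s a e = X^ s − scale a (X^ e)

  −-scale-cong : ∀ {f f' g g'} a → f ≋ f' → g ≋ g' → f − scale a g ≋ f' − scale a g'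
  −-scale-cong a f≋f' g≋g' t pt = +-cong (f≋f' t pt) (-‿cong (*-congˡ (g≋g' t pt)))

  binomial-cong : ∀ {s s' e e'} a → E s s' → E e e' → binomial s a e ≋ binomial s' a e'
  binomial-cong a s~s' e~e' = −-scale-cong a (X^-cong s~s') (X^-cong e~e')

  prodFin-cong : ∀ {m} {F G : Fin (suc m) → Elt} → (∀ i → F i ≋ G i) → prodFin F ≋ prodFin G
  prodFin-cong {zero}  F≋G = F≋G zero
  prodFin-cong {suc m} F≋G = ·-cong (F≋G zero) (prodFin-cong (λ i → F≋G (suc i)))

  X^-invariant : ∀ s → Invariant (X^ s)
  X^-invariant s _ _ x~y = when-⇔ (E? _ s) (E? _ s) (E-trans (E-sym x~y)) (E-trans x~y)

  binomial-invariant : ∀ s a e → Invariant (binomial s a e)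
  binomial-invariant s a e px py x~y =
    +-cong (X^-invariant s px py x~y) (-‿cong (*-congˡ (X^-invariant e px py x~y)))

  ·-invariant : ∀ f g → Invariant (f · g)
  ·-invariant f g _ _ x~y = ∑-cong reps (λ t → ∑-cong reps (λ u →
    when-⇔ (E? (t ⊕ u) _) (E? (t ⊕ u) _) (λ e → E-trans e x~y) (λ e → E-trans e (E-sym x~y))))

  prodFin-invariant : ∀ {m} (F : Fin (suc m) → Elt) → (∀ i → Invariant (F i)) → Invariant (prodFin F)
  prodFin-invariant {zero}  F F-inv = F-inv zero
  prodFin-invariant {suc m} F _     = ·-invariant (F zero) (prodFin (λ i → F (suc i)))

  Good-resp : ∀ {m} {s t : Fin (suc m) → Fin size} → (∀ i → E (s i) (t i)) → (∀ i → P (t i)) → Good s → Good t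
  Good-resp {s = s} {t} s~t pt (ps , good) = pt , λ a a≉0 e e-idem prod≈0 →
    good a a≉0 e (λ i → idem-of-s i (e-idem i))
      (λ x px → trans (prodFin-cong (λ i → binomial-cong (a i) (s~t i) E-refl) x px) (prod≈0 x px))
    where
    idem-of-s : ∀ i {e} → IsIdemOf (t i) e → IsIdemOf (s i) e
    idem-of-s i (pe , ee~e , m , e~mt) = pe , ee~e , m , E-trans e~mt (E-sym (E-mulSuc m (ps i) (pt i) (s~t i)))

record Homomorphism {S : FinCommSemigroup} (A B : Subquotient S) : Set where
  open FinCommSemigroup S
  private
    module A = Subquotient A
    module B = Subquotient B
  field
    ⟦_⟧          : Fin size → Fin size
    P-preserving : ∀ {x} → A.P x → B.P ⟦ x ⟧
    E-preserving : ∀ {x y} → A.P x → A.P y → A.E x y → B.E ⟦ x ⟧ ⟦ y ⟧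
    ⊕-homo       : ∀ {x y} → A.P x → A.P y → B.E ⟦ x ⊕ y ⟧ (⟦ x ⟧ ⊕ ⟦ y ⟧)

inclusion : ∀ S (T : Subset (FinCommSemigroup.size S)) (T-isSubgroup : IsSubgroup S (_∈ T))
          → Homomorphism (subgroup S T T-isSubgroup) (whole S)
inclusion S T T-isSubgroup = record
  { ⟦_⟧ = λ x → x ; P-preserving = λ _ → tt ; E-preserving = λ _ _ x≡y → x≡y ; ⊕-homo = λ _ _ → ≡.refl }

module Transfer (S : FinCommSemigroup) {c ℓ : Level} (K : Field c ℓ) {A B : Subquotient S} (ψ : Homomorphism A B) where
  open FinCommSemigroup S
  open Homomorphism ψ
  open Field K hiding (zero)
  open ListSum commutativeRing
  open SetoidReasoning setoid
  private
    module A = SemigroupRing S K A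
    module B = SemigroupRing S K B

  push : A.Elt → B.Elt
  push h y = ∑[ r ∈ A.reps ] when (B.E? ⟦ r ⟧ y) (h r)

  when-⟦⟧-invariant : ∀ y z → A.Invariant (λ r → when (B.E? ⟦ r ⟧ y) z)
  when-⟦⟧-invariant y z pr pr' r~r' = when-⇔ (B.E? _ y) (B.E? _ y)
    (B.E-trans (E-preserving pr' pr (A.E-sym r~r'))) (B.E-trans (E-preserving pr pr' r~r'))

  push-X^ : ∀ {s} → A.P s → push (A.X^ s) B.≋ B.X^ ⟦ s ⟧
  push-X^ {s} ps y _ = begin
    ∑[ r ∈ A.reps ] when (B.E? ⟦ r ⟧ y) (when (A.E? r s) 1#)
      ≈⟨ ∑-cong A.reps (λ r → when-comm (B.E? ⟦ r ⟧ y) (A.E? r s) 1#) ⟩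
    ∑[ r ∈ A.reps ] when (A.E? r s) (when (B.E? ⟦ r ⟧ y) 1#)
      ≈⟨ A.∑-δ ps _ (when-⟦⟧-invariant y 1#) ⟩
    when (B.E? ⟦ s ⟧ y) 1#
      ≈⟨ when-⇔ (B.E? ⟦ s ⟧ y) (B.E? y ⟦ s ⟧) B.E-sym B.E-sym ⟩
    B.X^ ⟦ s ⟧ y ∎

  push-binomial : ∀ {s e} a → A.P s → A.P e → push (A.binomial s a e) B.≋ B.binomial ⟦ s ⟧ a ⟦ e ⟧
  push-binomial {s} {e} a ps pe y py = begin
    ∑[ r ∈ A.reps ] when (B.E? ⟦ r ⟧ y) (A.X^ s r + - (a * A.X^ e r))
      ≈⟨ ∑-cong A.reps (λ r → trans (when-+ (B.E? ⟦ r ⟧ y) _ _)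
           (+-congˡ (trans (when-neg (B.E? ⟦ r ⟧ y) _) (-‿cong (sym (when-*ˡ (B.E? ⟦ r ⟧ y) a _)))))) ⟩
    ∑[ r ∈ A.reps ] (when (B.E? ⟦ r ⟧ y) (A.X^ s r) + - (a * when (B.E? ⟦ r ⟧ y) (A.X^ e r)))
      ≈⟨ ∑-linear A.reps a _ _ ⟩
    push (A.X^ s) y + - (a * push (A.X^ e) y)
      ≈⟨ +-cong (push-X^ ps y py) (-‿cong (*-congˡ (push-X^ pe y py))) ⟩
    B.binomial ⟦ s ⟧ a ⟦ e ⟧ y ∎

  push-·-expand : ∀ f g y → push (f A.· g) y
                ≈ ∑[ t ∈ A.reps ] ∑[ u ∈ A.reps ] when (B.E? (⟦ t ⟧ ⊕ ⟦ u ⟧) y) (f t * g u)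
  push-·-expand f g y = begin
    ∑[ r ∈ A.reps ] when (B.E? ⟦ r ⟧ y) (∑[ t ∈ A.reps ] ∑[ u ∈ A.reps ] when (A.E? (t ⊕ u) r) (f t * g u))
      ≈⟨ ∑-cong A.reps (λ r → trans (when-∑∑ (B.E? ⟦ r ⟧ y) A.reps A.reps _)
           (∑-cong A.reps (λ t → ∑-cong A.reps (λ u → when-comm (B.E? ⟦ r ⟧ y) (A.E? (t ⊕ u) r) _)))) ⟩
    ∑[ r ∈ A.reps ] ∑[ t ∈ A.reps ] ∑[ u ∈ A.reps ] when (A.E? (t ⊕ u) r) (when (B.E? ⟦ r ⟧ y) (f t * g u))
      ≈⟨ trans (∑-comm A.reps A.reps _) (∑-cong A.reps (λ t → ∑-comm A.reps A.reps _)) ⟩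
    ∑[ t ∈ A.reps ] ∑[ u ∈ A.reps ] ∑[ r ∈ A.reps ] when (A.E? (t ⊕ u) r) (when (B.E? ⟦ r ⟧ y) (f t * g u))
      ≈⟨ A.∑ᴿ-cong (λ pt → A.∑ᴿ-cong (λ pu → A.∑-δ′ (A.P-⊕ pt pu) _ (when-⟦⟧-invariant y _))) ⟩
    ∑[ t ∈ A.reps ] ∑[ u ∈ A.reps ] when (B.E? ⟦ t ⊕ u ⟧ y) (f t * g u)
      ≈⟨ A.∑ᴿ-cong (λ pt → A.∑ᴿ-cong (λ pu → when-⇔ (B.E? _ y) (B.E? _ y)
           (B.E-trans (B.E-sym (⊕-homo pt pu))) (B.E-trans (⊕-homo pt pu)))) ⟩
    ∑[ t ∈ A.reps ] ∑[ u ∈ A.reps ] when (B.E? (⟦ t ⟧ ⊕ ⟦ u ⟧) y) (f t * g u) ∎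

  ·-push-expand : ∀ f g y → (push f B.· push g) y
                ≈ ∑[ t ∈ A.reps ] ∑[ u ∈ A.reps ] when (B.E? (⟦ t ⟧ ⊕ ⟦ u ⟧) y) (f t * g u)
  ·-push-expand f g y = begin
    ∑[ v ∈ B.reps ] ∑[ w ∈ B.reps ] when (B.E? (v ⊕ w) y) (push f v * push g w)
      ≈⟨ ∑-cong B.reps (λ v → ∑-cong B.reps (λ w → distribute v w)) ⟩
    ∑[ v ∈ B.reps ] ∑[ w ∈ B.reps ] ∑[ t ∈ A.reps ] ∑[ u ∈ A.reps ] F t u v w
      ≈⟨ ∑∑-comm B.reps B.reps A.reps A.reps _ ⟩
    ∑[ t ∈ A.reps ] ∑[ u ∈ A.reps ] ∑[ v ∈ B.reps ] ∑[ w ∈ B.reps ] F t u v w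
      ≈⟨ A.∑ᴿ-cong (λ pt → A.∑ᴿ-cong (λ pu → collapse (P-preserving pt) (P-preserving pu))) ⟩
    ∑[ t ∈ A.reps ] ∑[ u ∈ A.reps ] when (B.E? (⟦ t ⟧ ⊕ ⟦ u ⟧) y) (f t * g u) ∎
    where
    F : Fin size → Fin size → Fin size → Fin size → Carrier
    F t u v w = when (B.E? ⟦ t ⟧ v) (when (B.E? ⟦ u ⟧ w) (when (B.E? (v ⊕ w) y) (f t * g u)))
    distribute : ∀ v w → when (B.E? (v ⊕ w) y) (push f v * push g w) ≈ ∑[ t ∈ A.reps ] ∑[ u ∈ A.reps ] F t u v w
    distribute v w = begin
      when (B.E? (v ⊕ w) y) (push f v * push g w)
        ≈⟨ when-cong (B.E? (v ⊕ w) y) (∑-*-∑ A.reps A.reps _ _) ⟩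
      when (B.E? (v ⊕ w) y) (∑[ t ∈ A.reps ] ∑[ u ∈ A.reps ] (when (B.E? ⟦ t ⟧ v) (f t) * when (B.E? ⟦ u ⟧ w) (g u)))
        ≈⟨ when-∑∑ (B.E? (v ⊕ w) y) A.reps A.reps _ ⟩
      ∑[ t ∈ A.reps ] ∑[ u ∈ A.reps ] when (B.E? (v ⊕ w) y) (when (B.E? ⟦ t ⟧ v) (f t) * when (B.E? ⟦ u ⟧ w) (g u))
        ≈⟨ ∑-cong A.reps (λ t → ∑-cong A.reps (λ u →
             trans (when-cong (B.E? (v ⊕ w) y)
                     (trans (when-*ʳ (B.E? ⟦ t ⟧ v) _ _) (when-cong (B.E? ⟦ t ⟧ v) (when-*ˡ (B.E? ⟦ u ⟧ w) _ _))))
                   (trans (when-comm (B.E? (v ⊕ w) y) (B.E? ⟦ t ⟧ v) _)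
                          (when-cong (B.E? ⟦ t ⟧ v) (when-comm (B.E? (v ⊕ w) y) (B.E? ⟦ u ⟧ w) _))))) ⟩
      ∑[ t ∈ A.reps ] ∑[ u ∈ A.reps ] F t u v w ∎
    collapse : ∀ {t u} → B.P ⟦ t ⟧ → B.P ⟦ u ⟧
             → ∑[ v ∈ B.reps ] ∑[ w ∈ B.reps ] F t u v w ≈ when (B.E? (⟦ t ⟧ ⊕ ⟦ u ⟧) y) (f t * g u)
    collapse {t} {u} pt pu = begin
      ∑[ v ∈ B.reps ] ∑[ w ∈ B.reps ] F t u v w
        ≈⟨ B.∑ᴿ-cong (λ pv → trans (sym (when-∑ (B.E? ⟦ t ⟧ _) B.reps _))
             (when-cong (B.E? ⟦ t ⟧ _) (B.∑-δ′ pu _ (B.when-E-⊕ˡ-invariant y _ pv)))) ⟩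
      ∑[ v ∈ B.reps ] when (B.E? ⟦ t ⟧ v) (when (B.E? (v ⊕ ⟦ u ⟧) y) (f t * g u))
        ≈⟨ B.∑-δ′ pt _ (B.when-E-⊕ʳ-invariant y _ pu) ⟩
      when (B.E? (⟦ t ⟧ ⊕ ⟦ u ⟧) y) (f t * g u) ∎

  push-· : ∀ f g → push (f A.· g) B.≋ push f B.· push g
  push-· f g y _ = trans (push-·-expand f g y) (sym (·-push-expand f g y))

  push-prodFin : ∀ {m} (F : Fin (suc m) → A.Elt) → push (A.prodFin F) B.≋ B.prodFin (λ i → push (F i))
  push-prodFin {zero}  F = λ _ _ → refl
  push-prodFin {suc m} F = B.≋-trans (push-· (F zero) _) (B.·-cong B.≋-refl (push-prodFin (λ i → F (suc i))))

  push-zero : ∀ {h} → A.IsZero h → B.IsZero (push h)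
  push-zero h≈0 y _ =
    ∑-zeroᴬ A.reps⊆P (λ {r} pr → trans (when-cong (B.E? ⟦ r ⟧ y) (h≈0 r pr)) (when-zero (B.E? ⟦ r ⟧ y)))

  ⟦⟧-mulSuc : ∀ m {x} → A.P x → B.E ⟦ mulSuc S m x ⟧ (mulSuc S m ⟦ x ⟧)
  ⟦⟧-mulSuc zero    px = B.E-refl
  ⟦⟧-mulSuc (suc m) px = B.E-trans (⊕-homo px (A.P-mulSuc m px))
    (B.E-⊕ˡ (P-preserving (A.P-mulSuc m px)) (B.P-mulSuc m (P-preserving px)) (P-preserving px) (⟦⟧-mulSuc m px))

  IsIdemOf-preserving : ∀ {s e} → A.P s → A.IsIdemOf s e → B.IsIdemOf ⟦ s ⟧ ⟦ e ⟧
  IsIdemOf-preserving ps (pe , ee~e , m , e~ms) =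
      P-preserving pe
    , B.E-trans (B.E-sym (⊕-homo pe pe)) (E-preserving (A.P-⊕ pe pe) pe ee~e)
    , m , B.E-trans (E-preserving pe (A.P-mulSuc m ps) e~ms) (⟦⟧-mulSuc m ps)

  push-prodFin-binomial : ∀ {m} {s e e′ : Fin (suc m) → Fin size} (a : Fin (suc m) → Carrier)
    → (∀ i → A.P (s i)) → (∀ i → A.P (e i)) → (∀ i → B.E ⟦ e i ⟧ (e′ i))
    → push (A.prodFin (λ i → A.binomial (s i) (a i) (e i))) B.≋ B.prodFin (λ i → B.binomial ⟦ s i ⟧ (a i) (e′ i))
  push-prodFin-binomial {s = s} {e} a ps pe e~e′ = B.≋-trans (push-prodFin (λ i → A.binomial (s i) (a i) (e i)))
    (B.prodFin-cong (λ i → B.≋-trans (push-binomial (a i) (ps i) (pe i)) (B.binomial-cong (a i) B.E-refl (e~e′ i))))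

  Good-reflecting : ∀ {m} {s : Fin (suc m) → Fin size} → (∀ i → A.P (s i)) → B.Good (λ i → ⟦ s i ⟧) → A.Good s
  Good-reflecting ps (_ , good) = ps , λ a a≉0 e e-idem prod≈0 →
    good a a≉0 (λ i → ⟦ e i ⟧) (λ i → IsIdemOf-preserving (ps i) (e-idem i))
      (B.≋-trans (B.≋-sym (push-prodFin-binomial a ps (λ i → proj₁ (e-idem i)) (λ _ → B.E-refl))) (push-zero prod≈0))

  module _ (E-reflecting : ∀ {x y} → A.P x → A.P y → B.E ⟦ x ⟧ ⟦ y ⟧ → A.E x y) where

    push-reflects-zero : ∀ {h} → A.Invariant h → B.IsZero (push h) → A.IsZero h
    push-reflects-zero {h} h-inv push≈0 x px = begin
      h x
        ≈⟨ A.∑-δ px h h-inv ⟨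
      ∑[ r ∈ A.reps ] when (A.E? r x) (h r)
        ≈⟨ A.∑ᴿ-cong (λ pr → when-⇔ (A.E? _ x) (B.E? _ _) (E-preserving pr px) (E-reflecting pr px)) ⟩
      push h ⟦ x ⟧
        ≈⟨ push≈0 ⟦ x ⟧ (P-preserving px) ⟩
      0# ∎

    IsIdemOf-reflecting : ∀ {s e} → A.P s → B.IsIdemOf ⟦ s ⟧ e → ∃ λ e′ → A.IsIdemOf s e′ × B.E ⟦ e′ ⟧ e
    IsIdemOf-reflecting {s} {e} ps (pe , ee~e , m , e~m⟦s⟧) =
      mulSuc S m s , (pm , E-reflecting (A.P-⊕ pm pm) pm idempotent , m , A.E-refl) , m~e
      where
      pm   = A.P-mulSuc m ps
      p⟦m⟧ = P-preserving pm
      m~e : B.E ⟦ mulSuc S m s ⟧ e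
      m~e = B.E-trans (⟦⟧-mulSuc m ps) (B.E-sym e~m⟦s⟧)
      idempotent : B.E ⟦ mulSuc S m s ⊕ mulSuc S m s ⟧ ⟦ mulSuc S m s ⟧
      idempotent = B.E-trans (⊕-homo pm pm) (B.E-trans (B.E-⊕ʳ p⟦m⟧ pe p⟦m⟧ m~e)
                     (B.E-trans (B.E-⊕ˡ p⟦m⟧ pe pe m~e) (B.E-trans ee~e (B.E-sym m~e))))

    Good-preserving : ∀ {m} {s : Fin (suc m) → Fin size} → A.Good s → B.Good (λ i → ⟦ s i ⟧)
    Good-preserving {m} {s} (ps , good) = (λ i → P-preserving (ps i)) , refute
      where
      refute : ∀ a → (∀ i → ¬ (a i ≈ 0#)) → ∀ e → (∀ i → B.IsIdemOf ⟦ s i ⟧ (e i))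
             → ¬ B.IsZero (B.prodFin (λ i → B.binomial ⟦ s i ⟧ (a i) (e i)))
      refute a a≉0 e e-idem prod≈0 = good a a≉0 e′ e′-idem
        (push-reflects-zero (A.prodFin-invariant _ (λ i → A.binomial-invariant (s i) (a i) (e′ i)))
          (B.≋-trans (push-prodFin-binomial a ps (λ i → proj₁ (e′-idem i)) ⟦e′⟧~e) prod≈0))
        where
        reflected : ∀ i → ∃ λ e′ → A.IsIdemOf (s i) e′ × B.E ⟦ e′ ⟧ (e i)
        reflected i = IsIdemOf-reflecting (ps i) (e-idem i)
        e′ : Fin (suc m) → Fin size
        e′ i = proj₁ (reflected i)
        e′-idem : ∀ i → A.IsIdemOf (s i) (e′ i)
        e′-idem i = proj₁ (proj₂ (reflected i))
        ⟦e′⟧~e : ∀ i → B.E ⟦ e′ i ⟧ (e i)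
        ⟦e′⟧~e i = proj₂ (proj₂ (reflected i))

module SemigroupProperties (S : FinCommSemigroup) where
  open FinCommSemigroup S
  open ≡ using (refl; sym; trans; cong; cong₂)

  commutativeSemigroup : CommutativeSemigroup 0ℓ 0ℓ
  commutativeSemigroup = record
    { Carrier = Fin size ; _≈_ = _≡_ ; _∙_ = _⊕_
    ; isCommutativeSemigroup = record
      { isSemigroup = record { isMagma = record { isEquivalence = ≡.isEquivalence ; ∙-cong = cong₂ _⊕_ } ; assoc = assoc }
      ; comm = comm
      }
    }

  open CommSemigroupProperties commutativeSemigroup using (interchange; x∙yz≈y∙xz; xy∙z≈xz∙y) public

  mulSuc-+ : ∀ m n x → mulSuc S m x ⊕ mulSuc S n x ≡ mulSuc S (suc (m +ℕ n)) x
  mulSuc-+ zero    n x = refl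
  mulSuc-+ (suc m) n x = trans (assoc x (mulSuc S m x) (mulSuc S n x)) (cong (x ⊕_) (mulSuc-+ m n x))

  mulSuc-distrib-⊕ : ∀ m x y → mulSuc S m (x ⊕ y) ≡ mulSuc S m x ⊕ mulSuc S m y
  mulSuc-distrib-⊕ zero    x y = refl
  mulSuc-distrib-⊕ (suc m) x y = trans (cong ((x ⊕ y) ⊕_) (mulSuc-distrib-⊕ m x y)) (interchange x y _ _)

  mulSuc-idempotent : ∀ m {g} → g ⊕ g ≡ g → mulSuc S m g ≡ g
  mulSuc-idempotent zero    gg≡g = refl
  mulSuc-idempotent (suc m) gg≡g = trans (cong (_ ⊕_) (mulSuc-idempotent m gg≡g)) gg≡g

  mulSuc-absorbs : ∀ m {g x} → g ⊕ x ≡ x → g ⊕ mulSuc S m x ≡ mulSuc S m x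
  mulSuc-absorbs zero    gx≡x = gx≡x
  mulSuc-absorbs (suc m) {g} {x} gx≡x = trans (sym (assoc g x _)) (cong (_⊕ mulSuc S m x) gx≡x)

  InCyc-⊕ : ∀ {a x y} → InCyc S a x → InCyc S a y → InCyc S a (x ⊕ y)
  InCyc-⊕ {a} (m , refl) (n , refl) = suc (m +ℕ n) , mulSuc-+ m n a

  InCyc-mulSuc : ∀ {a x} m → InCyc S a x → InCyc S a (mulSuc S m x)
  InCyc-mulSuc zero    ax = ax
  InCyc-mulSuc (suc m) ax = InCyc-⊕ ax (InCyc-mulSuc m ax)

  ⨁ : ∀ {m} → (Fin (suc m) → Fin size) → Fin size
  ⨁ {zero}  e = e zero
  ⨁ {suc m} e = e zero ⊕ ⨁ (λ i → e (suc i))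

  ⨁-idempotent : ∀ {m} (e : Fin (suc m) → Fin size) → (∀ i → e i ⊕ e i ≡ e i) → ⨁ e ⊕ ⨁ e ≡ ⨁ e
  ⨁-idempotent {zero}  e ee≡e = ee≡e zero
  ⨁-idempotent {suc m} e ee≡e = trans (interchange (e zero) _ (e zero) _)
    (cong₂ _⊕_ (ee≡e zero) (⨁-idempotent (λ i → e (suc i)) (λ i → ee≡e (suc i))))

  ⨁-absorbs : ∀ {m} (e : Fin (suc m) → Fin size) → (∀ i → e i ⊕ e i ≡ e i) → ∀ i → e i ⊕ ⨁ e ≡ ⨁ e
  ⨁-absorbs {zero}  e ee≡e zero    = ee≡e zero
  ⨁-absorbs {suc m} e ee≡e zero    = trans (sym (assoc (e zero) (e zero) _)) (cong (_⊕ ⨁ (λ i → e (suc i))) (ee≡e zero))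
  ⨁-absorbs {suc m} e ee≡e (suc i) = trans (x∙yz≈y∙xz (e (suc i)) (e zero) _)
    (cong (e zero ⊕_) (⨁-absorbs (λ i → e (suc i)) (λ i → ee≡e (suc i)) i))

module Clifford (S : FinCommSemigroup) (clifford : IsClifford S) where
  open FinCommSemigroup S
  open SemigroupProperties S
  open ≡ using (refl; sym; trans; cong; cong₂; subst)
  open ≡.≡-Reasoning

  infix 21 _⁻¹
  _⁻¹ : Fin size → Fin size
  x ⁻¹ = proj₁ (clifford x)

  -- The paper's e(x): `idem∈⟨⟩` shows it is the idempotent of ⟨x⟩.
  idem : Fin size → Fin size
  idem x = x ⊕ x ⁻¹

  idem-identityˡ : ∀ x → idem x ⊕ x ≡ x
  idem-identityˡ x = proj₁ (proj₂ (clifford x))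

  idem-identityʳ : ∀ x → x ⊕ idem x ≡ x
  idem-identityʳ x = trans (comm x (idem x)) (idem-identityˡ x)

  idem-idempotent : ∀ x → idem x ⊕ idem x ≡ idem x
  idem-idempotent x = trans (sym (assoc (idem x) x (x ⁻¹))) (cong (_⊕ x ⁻¹) (idem-identityˡ x))

  idem-unique : ∀ {g x} t → g ⊕ x ≡ x → g ≡ x ⊕ t → g ≡ idem x
  idem-unique {g} {x} t gx≡x g≡xt = begin
    g                   ≡⟨ sym idem-g ⟩
    idem x ⊕ g          ≡⟨ comm (idem x) g ⟩
    g ⊕ (x ⊕ x ⁻¹)      ≡⟨ sym (assoc g x (x ⁻¹)) ⟩
    (g ⊕ x) ⊕ x ⁻¹      ≡⟨ cong (_⊕ x ⁻¹) gx≡x ⟩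
    idem x              ∎
    where
    idem-g : idem x ⊕ g ≡ g
    idem-g = begin
      idem x ⊕ g         ≡⟨ cong (idem x ⊕_) g≡xt ⟩
      idem x ⊕ (x ⊕ t)   ≡⟨ sym (assoc (idem x) x t) ⟩
      (idem x ⊕ x) ⊕ t   ≡⟨ cong (_⊕ t) (idem-identityˡ x) ⟩
      x ⊕ t              ≡⟨ sym g≡xt ⟩
      g                  ∎

  idem-⊕ : ∀ x y → idem (x ⊕ y) ≡ idem x ⊕ idem y
  idem-⊕ x y = sym (idem-unique (x ⁻¹ ⊕ y ⁻¹)
    (trans (interchange (idem x) (idem y) x y) (cong₂ _⊕_ (idem-identityˡ x) (idem-identityˡ y)))
    (interchange x (x ⁻¹) y (y ⁻¹)))

  idem-⁻¹ : ∀ x → idem (x ⁻¹) ≡ idem x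
  idem-⁻¹ x = sym (idem-unique x (trans (cong (_⊕ x ⁻¹) (comm x (x ⁻¹))) (proj₂ (proj₂ (clifford x)))) (comm x (x ⁻¹)))

  idem-of-idempotent : ∀ {g} → g ⊕ g ≡ g → idem g ≡ g
  idem-of-idempotent gg≡g = sym (idem-unique _ gg≡g (sym gg≡g))

  idem-mulSuc : ∀ m x → idem (mulSuc S m x) ≡ idem x
  idem-mulSuc zero    x = refl
  idem-mulSuc (suc m) x = trans (idem-⊕ x _) (trans (cong (idem x ⊕_) (idem-mulSuc m x)) (idem-idempotent x))

  idempotent∈⟨⟩⇒≡idem : ∀ {x y} → y ⊕ y ≡ y → InCyc S x y → y ≡ idem x
  idempotent∈⟨⟩⇒≡idem {x} yy≡y (m , refl) = trans (sym (idem-of-idempotent yy≡y)) (idem-mulSuc m x)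

  -- Pigeonhole gives M = M ⊕ D for multiples M, D of a; adding M's inverse yields e(a) = e(a) ⊕ D = D.
  idem∈⟨⟩ : ∀ a → ∃ λ q → idem a ≡ mulSuc S q a
  idem∈⟨⟩ a with pigeonhole (n<1+n size) (λ i → mulSuc S (toℕ i) a)
  ... | i , j , i<j , Mi≡Mj with m≤n⇒∃[o]m+o≡n i<j
  ... | d , i+1+d≡j = d , (begin
      idem a              ≡⟨ sym MM⁻¹≡idem ⟩
      M ⊕ M⁻¹             ≡⟨ cong (_⊕ M⁻¹) M≡MD ⟩
      (M ⊕ D) ⊕ M⁻¹       ≡⟨ xy∙z≈xz∙y M D M⁻¹ ⟩
      (M ⊕ M⁻¹) ⊕ D       ≡⟨ cong (_⊕ D) MM⁻¹≡idem ⟩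
      idem a ⊕ D          ≡⟨ mulSuc-absorbs d (idem-identityˡ a) ⟩
      D                   ∎)
    where
    M   = mulSuc S (toℕ i) a
    M⁻¹ = mulSuc S (toℕ i) (a ⁻¹)
    D   = mulSuc S d a
    MM⁻¹≡idem : M ⊕ M⁻¹ ≡ idem a
    MM⁻¹≡idem = trans (sym (mulSuc-distrib-⊕ (toℕ i) a (a ⁻¹))) (mulSuc-idempotent (toℕ i) (idem-idempotent a))
    M≡MD : M ≡ M ⊕ D
    M≡MD = trans Mi≡Mj (trans (cong (λ k → mulSuc S k a) (sym i+1+d≡j)) (sym (mulSuc-+ (toℕ i) d a)))

  ⟨⟩-inverse : ∀ a → ∃ λ b → InCyc S a b × (a ⊕ b ≡ idem a)
  ⟨⟩-inverse a with idem∈⟨⟩ a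
  ... | zero  , idem≡a  = a , (zero , refl) , subst (λ z → z ⊕ z ≡ idem a) idem≡a (idem-idempotent a)
  ... | suc q , idem≡Ma = mulSuc S q a , (q , refl) , sym idem≡Ma

  ⟨⟩-isSubgroup : ∀ a → εIsZero S a
  ⟨⟩-isSubgroup a with ⟨⟩-inverse a
  ... | b , ab , a⊕b≡idem =
      (λ _ _ → InCyc-⊕) , idem a , idem∈⟨⟩ a
    , (λ { _ (m , refl) → mulSuc-absorbs m (idem-identityˡ a) })
    , λ { _ (m , refl) → mulSuc S m b , InCyc-mulSuc m ab
                        , trans (sym (mulSuc-distrib-⊕ m a b))
                                (trans (cong (mulSuc S m) a⊕b≡idem) (mulSuc-idempotent m (idem-idempotent a))) }

  InPrin⇒∃ : ∀ {x y} → InPrin S x y → ∃ λ s → y ≡ x ⊕ s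
  InPrin⇒∃ {x} (inj₁ refl) = idem x , sym (idem-identityʳ x)
  InPrin⇒∃ (inj₂ y≡x⊕s)   = y≡x⊕s

  idem-below : ∀ {a y} s → y ≡ a ⊕ s → idem a ⊕ idem y ≡ idem y
  idem-below {a} {y} s y≡a⊕s = trans (sym (assoc (idem a) y (y ⁻¹))) (cong (_⊕ y ⁻¹) idem-a⊕y)
    where
    idem-a⊕y : idem a ⊕ y ≡ y
    idem-a⊕y = trans (cong (idem a ⊕_) y≡a⊕s)
      (trans (sym (assoc (idem a) a s)) (trans (cong (_⊕ s) (idem-identityˡ a)) (sym y≡a⊕s)))

  H⇒idem-≡ : ∀ {a x} → H S a x → idem x ≡ idem a
  H⇒idem-≡ {a} {x} x∈Ha with InPrin⇒∃ (proj₁ (x∈Ha x) (inj₁ refl)) | InPrin⇒∃ (proj₂ (x∈Ha a) (inj₁ refl))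
  ... | s , x≡a⊕s | t , a≡x⊕t = begin
    idem x              ≡⟨ sym (idem-below s x≡a⊕s) ⟩
    idem a ⊕ idem x     ≡⟨ comm (idem a) (idem x) ⟩
    idem x ⊕ idem a     ≡⟨ idem-below t a≡x⊕t ⟩
    idem a              ∎

  idem-≡⇒InPrin : ∀ {x a y} → idem x ≡ idem a → InPrin S x y → InPrin S a y
  idem-≡⇒InPrin {x} {a} {y} idem-x≡idem-a y∈xS with InPrin⇒∃ y∈xS
  ... | s , y≡x⊕s = inj₂ ((a ⁻¹ ⊕ x) ⊕ s , (begin
    y                          ≡⟨ y≡x⊕s ⟩
    x ⊕ s                      ≡⟨ cong (_⊕ s) (trans (sym (idem-identityˡ x)) (cong (_⊕ x) idem-x≡idem-a)) ⟩
    ((a ⊕ a ⁻¹) ⊕ x) ⊕ s       ≡⟨ cong (_⊕ s) (assoc a (a ⁻¹) x) ⟩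
    (a ⊕ (a ⁻¹ ⊕ x)) ⊕ s       ≡⟨ assoc a _ s ⟩
    a ⊕ ((a ⁻¹ ⊕ x) ⊕ s)       ∎))

  idem-≡⇒H : ∀ {a x} → idem x ≡ idem a → H S a x
  idem-≡⇒H idem-x≡idem-a y = idem-≡⇒InPrin idem-x≡idem-a , idem-≡⇒InPrin (sym idem-x≡idem-a)

  H-refl : ∀ a → H S a a
  H-refl a y = (λ p → p) , (λ p → p)

  H-⊕ : ∀ {a x y} → H S a x → H S a y → H S a (x ⊕ y)
  H-⊕ {a} {x} {y} x∈Ha y∈Ha =
    idem-≡⇒H (trans (idem-⊕ x y) (trans (cong₂ _⊕_ (H⇒idem-≡ x∈Ha) (H⇒idem-≡ y∈Ha)) (idem-idempotent a)))

  H-idem : ∀ a → H S a (idem a)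
  H-idem a = idem-≡⇒H (idem-of-idempotent (idem-idempotent a))

  H-⁻¹ : ∀ {a x} → H S a x → H S a (x ⁻¹)
  H-⁻¹ {a} {x} x∈Ha = idem-≡⇒H (trans (idem-⁻¹ x) (H⇒idem-≡ x∈Ha))

  H-identityˡ : ∀ {a x} → H S a x → idem a ⊕ x ≡ x
  H-identityˡ {a} {x} x∈Ha = trans (cong (_⊕ x) (sym (H⇒idem-≡ x∈Ha))) (idem-identityˡ x)

  H-identityʳ : ∀ {a x} → H S a x → x ⊕ idem a ≡ x
  H-identityʳ {a} {x} x∈Ha = trans (comm x (idem a)) (H-identityˡ x∈Ha)

  H-isSubgroup : ∀ a → IsSubgroup S (H S a)
  H-isSubgroup a = (λ _ _ → H-⊕) , idem a , H-idem a , (λ _ → H-identityˡ)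
                 , λ x x∈Ha → x ⁻¹ , H-⁻¹ x∈Ha , H⇒idem-≡ x∈Ha

  H-maximal : ∀ a (P : Fin size → Set) → IsSubgroup S P → P a → ∀ x → P x → H S a x
  H-maximal a P (_ , u , _ , u-identity , inverse) pa x px = idem-≡⇒H (trans (sym (u≡idem px)) (u≡idem pa))
    where
    u≡idem : ∀ {z} → P z → u ≡ idem z
    u≡idem {z} pz with inverse z pz
    ... | w , _ , z⊕w≡u = idem-unique w (u-identity z pz) (sym z⊕w≡u)

  St⇒translate∈H : ∀ {a c} → St S a c → H S a (c ⊕ idem a)
  St⇒translate∈H {a} c∈St = c∈St (idem a) (H-idem a)

  γEq⇒translate-≡ : ∀ {a c d} → γEq S a c d → c ⊕ idem a ≡ d ⊕ idem a
  γEq⇒translate-≡ {a} γc≡γd = γc≡γd (idem a) (H-idem a)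

  translate-≡⇒γEq : ∀ {a c d} → c ⊕ idem a ≡ d ⊕ idem a → γEq S a c d
  translate-≡⇒γEq {a} {c} {d} c⊕idem≡d⊕idem x x∈Ha = begin
    c ⊕ x               ≡⟨ cong (c ⊕_) (sym (H-identityˡ x∈Ha)) ⟩
    c ⊕ (idem a ⊕ x)    ≡⟨ sym (assoc c _ x) ⟩
    (c ⊕ idem a) ⊕ x    ≡⟨ cong (_⊕ x) c⊕idem≡d⊕idem ⟩
    (d ⊕ idem a) ⊕ x    ≡⟨ assoc d _ x ⟩
    d ⊕ (idem a ⊕ x)    ≡⟨ cong (d ⊕_) (H-identityˡ x∈Ha) ⟩
    d ⊕ x               ∎

  translate-⊕ : ∀ a c d → (c ⊕ d) ⊕ idem a ≡ (c ⊕ idem a) ⊕ (d ⊕ idem a)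
  translate-⊕ a c d = trans (cong ((c ⊕ d) ⊕_) (sym (idem-idempotent a))) (interchange c d _ _)

  schützenbergerIso : ∀ a → SchutzenbergerIso S a
  schützenbergerIso a =
      (_⊕ idem a)
    , (λ _ → St⇒translate∈H)
    , (λ _ _ _ _ → γEq⇒translate-≡)
    , (λ _ _ _ _ → translate-≡⇒γEq)
    , (λ h h∈Ha → h , (λ _ → H-⊕ h∈Ha) , H-identityʳ h∈Ha)
    , λ c d _ _ → translate-⊕ a c d

module _ (S : FinCommSemigroup) (clifford : IsClifford S) where
  open FinCommSemigroup S
  open Clifford S clifford

  translation : ∀ a → Homomorphism (schützenberger S a) (whole S)
  translation a = record
    { ⟦_⟧ = _⊕ idem a ; P-preserving = λ _ → tt ; E-preserving = λ _ _ → γEq⇒translate-≡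
    ; ⊕-homo = λ {c} {d} _ _ → translate-⊕ a c d }

module Stabilisation (S : FinCommSemigroup) (clifford : IsClifford S) {c ℓ : Level} (K : Field c ℓ) where
  open FinCommSemigroup S
  open Clifford S clifford
  open SemigroupProperties S using (⨁; ⨁-idempotent; ⨁-absorbs)
  open SemigroupRing S K (whole S)
  open Field K using (Carrier)
  open CommSemigroupProperties ·-commutativeSemigroup using () renaming (interchange to ·-interchange)
  open CommutativeSemigroup ·-commutativeSemigroup using (setoid)
  open SetoidReasoning setoid

  X^-idempotent : ∀ {f} → f ⊕ f ≡ f → X^ f · X^ f ≋ X^ f
  X^-idempotent ff≡f = ≋-trans (X^-· tt tt) (X^-cong ff≡f)

  X^-absorbs-binomial : ∀ {f e} s a → e ⊕ f ≡ f → X^ f · binomial s a e ≋ binomial (s ⊕ f) a f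
  X^-absorbs-binomial {f} {e} s a e⊕f≡f = begin
    X^ f · (X^ s − scale a (X^ e))          ≈⟨ ·-distribˡ-− (X^ f) (X^ s) (X^ e) a ⟩
    (X^ f · X^ s) − scale a (X^ f · X^ e)   ≈⟨ −-scale-cong a (X^-· tt tt) (X^-· tt tt) ⟩
    binomial (f ⊕ s) a (f ⊕ e)              ≈⟨ binomial-cong a (comm f s) (≡.trans (comm f e) e⊕f≡f) ⟩
    binomial (s ⊕ f) a f                    ∎

  X^-·-distrib : ∀ {f} → f ⊕ f ≡ f → ∀ u v → X^ f · (u · v) ≋ (X^ f · u) · (X^ f · v)
  X^-·-distrib {f} ff≡f u v = begin
    X^ f · (u · v)               ≈⟨ ·-cong (X^-idempotent ff≡f) ≋-refl ⟨
    (X^ f · X^ f) · (u · v)      ≈⟨ ·-interchange (X^ f) (X^ f) u v ⟩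
    (X^ f · u) · (X^ f · v)      ∎

  X^-·-prodFin : ∀ {f} → f ⊕ f ≡ f → ∀ {m} (F : Fin (suc m) → Elt)
               → X^ f · prodFin F ≋ prodFin (λ i → X^ f · F i)
  X^-·-prodFin ff≡f {zero}  F = ≋-refl
  X^-·-prodFin ff≡f {suc m} F =
    ≋-trans (X^-·-distrib ff≡f (F zero) _) (·-cong ≋-refl (X^-·-prodFin ff≡f (λ i → F (suc i))))

  prodFin-absorbs : ∀ {m} (F : Fin (suc m) → Elt) (e : Fin (suc m) → Fin size)
                  → (∀ i → F i ≋ X^ (e i) · F i) → prodFin F ≋ X^ (⨁ e) · prodFin F
  prodFin-absorbs {zero}  F e F≋eF = F≋eF zero
  prodFin-absorbs {suc m} F e F≋eF = begin
    F zero · R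
      ≈⟨ ·-cong (F≋eF zero) (prodFin-absorbs (λ i → F (suc i)) (λ i → e (suc i)) (λ i → F≋eF (suc i))) ⟩
    (X^ (e zero) · F zero) · (X^ f′ · R)
      ≈⟨ ·-interchange _ _ _ _ ⟩
    (X^ (e zero) · X^ f′) · (F zero · R)
      ≈⟨ ·-cong (X^-· tt tt) ≋-refl ⟩
    X^ (e zero ⊕ f′) · (F zero · R) ∎
    where
    R  = prodFin (λ i → F (suc i))
    f′ = ⨁ (λ i → e (suc i))

  module _ {m} (s : Fin (suc m) → Fin size) where

    stabiliser : Fin size
    stabiliser = ⨁ (λ j → idem (s j))

    stabiliser-idempotent : stabiliser ⊕ stabiliser ≡ stabiliser
    stabiliser-idempotent = ⨁-idempotent _ (λ j → idem-idempotent (s j))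

    idem-below-stabiliser : ∀ i → idem (s i) ⊕ stabiliser ≡ stabiliser
    idem-below-stabiliser = ⨁-absorbs _ (λ j → idem-idempotent (s j))

    idem-stabilised : ∀ i → idem (s i ⊕ stabiliser) ≡ stabiliser
    idem-stabilised i = ≡.trans (idem-⊕ (s i) stabiliser)
      (≡.trans (≡.cong (idem (s i) ⊕_) (idem-of-idempotent stabiliser-idempotent)) (idem-below-stabiliser i))

    prodFin-stabilise : ∀ (a : Fin (suc m) → Carrier) → prodFin (λ i → binomial (s i) (a i) (idem (s i)))
                            ≋ prodFin (λ i → binomial (s i ⊕ stabiliser) (a i) stabiliser)
    prodFin-stabilise a = begin
      prodFin F
        ≈⟨ prodFin-absorbs F (λ i → idem (s i)) (λ i → ≋-sym (idem-absorbs i)) ⟩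
      X^ stabiliser · prodFin F
        ≈⟨ X^-·-prodFin stabiliser-idempotent F ⟩
      prodFin (λ i → X^ stabiliser · F i)
        ≈⟨ prodFin-cong (λ i → X^-absorbs-binomial (s i) (a i) (idem-below-stabiliser i)) ⟩
      prodFin (λ i → binomial (s i ⊕ stabiliser) (a i) stabiliser) ∎
      where
      F : Fin (suc m) → Elt
      F i = binomial (s i) (a i) (idem (s i))
      idem-absorbs : ∀ i → X^ (idem (s i)) · F i ≋ F i
      idem-absorbs i = ≋-trans (X^-absorbs-binomial (s i) (a i) (idem-idempotent (s i)))
                               (binomial-cong (a i) (idem-identityʳ (s i)) ≡.refl)

    Good-stabilise : Good s → Good (λ i → s i ⊕ stabiliser)
    Good-stabilise (_ , good) = (λ _ → tt) , λ a a≉0 e e-idem prod≈0 →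
      good a a≉0 (λ i → idem (s i)) (λ i → tt , idem-idempotent (s i) , idem∈⟨⟩ (s i))
        (≋-trans (prodFin-stabilise a)
          (≋-trans (prodFin-cong (λ i → binomial-cong (a i) ≡.refl (≡.sym (e≡stabiliser (e-idem i))))) prod≈0))
      where
      e≡stabiliser : ∀ {i e} → IsIdemOf (s i ⊕ stabiliser) e → e ≡ stabiliser
      e≡stabiliser {i} (_ , ee≡e , e∈⟨⟩) = ≡.trans (idempotent∈⟨⟩⇒≡idem ee≡e e∈⟨⟩) (idem-stabilised i)

toSubset : ∀ {n} {Q : Fin n → Set} → (∀ x → Dec (Q x)) → Subset n
toSubset Q? = Vec.tabulate (λ x → does (Q? x))

∈-toSubset⁺ : ∀ {n} {Q : Fin n → Set} (Q? : ∀ x → Dec (Q x)) {x} → Q x → x ∈ toSubset Q?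
∈-toSubset⁺ Q? {x} qx = lookup⇒[]= x (toSubset Q?) (≡.trans (lookup∘tabulate _ x) (dec-true (Q? x) qx))

∈-toSubset⁻ : ∀ {n} {Q : Fin n → Set} (Q? : ∀ x → Dec (Q x)) {x} → x ∈ toSubset Q? → Q x
∈-toSubset⁻ Q? {x} x∈Q = decidable-stable (Q? x) λ ¬qx →
  contradiction (≡.trans (≡.sym ([]=⇒lookup x∈Q)) (≡.trans (lookup∘tabulate _ x) (dec-false (Q? x) ¬qx))) λ ()

IsSubgroup-resp : ∀ {S : FinCommSemigroup} {P Q : Fin (FinCommSemigroup.size S) → Set}
                → (∀ {x} → P x → Q x) → (∀ {x} → Q x → P x) → IsSubgroup S P → IsSubgroup S Q
IsSubgroup-resp P⇒Q Q⇒P (⊕-closed , e , pe , e-identity , inverse) =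
    (λ x y qx qy → P⇒Q (⊕-closed x y (Q⇒P qx) (Q⇒P qy)))
  , e , P⇒Q pe , (λ x qx → e-identity x (Q⇒P qx))
  , λ x qx → let (y , py , x⊕y≡e) = inverse x (Q⇒P qx) in y , P⇒Q py , x⊕y≡e

module Reduction (S : FinCommSemigroup) (clifford : IsClifford S) {c ℓ : Level} (K : Field c ℓ) where
  open FinCommSemigroup S
  open Clifford S clifford
  open Stabilisation S clifford K using (stabiliser; stabiliser-idempotent; idem-stabilised; Good-stabilise)
  open Transfer S K using (Good-preserving; Good-reflecting)
  private
    module 𝕊 = SemigroupRing S K (whole S)
    module Γ a = SemigroupRing S K (schützenberger S a)
    module 𝔾 T T-isSubgroup = SemigroupRing S K (subgroup S T T-isSubgroup)

  stabilised∈H : ∀ {m} (s : Fin (suc m) → Fin size) i → H S (stabiliser s) (s i ⊕ stabiliser s)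
  stabilised∈H s i = idem-≡⇒H (≡.trans (idem-stabilised s i) (≡.sym (idem-of-idempotent (stabiliser-idempotent s))))

  H-class : Fin size → Subset size
  H-class a = toSubset (H? S a)

  H-class-isSubgroup : ∀ a → IsSubgroup S (_∈ H-class a)
  H-class-isSubgroup a = IsSubgroup-resp {S} (∈-toSubset⁺ (H? S a)) (∈-toSubset⁻ (H? S a)) (H-isSubgroup a)

  DUpper-via-Schützenberger : ∀ k → 𝕊.DUpper k ⇔ (∀ a → Γ.DUpper a k)
  DUpper-via-Schützenberger k = mk⇔ to from
    where
    to : 𝕊.DUpper k → ∀ a → Γ.DUpper a k
    to bound a m s good = bound m _ (Good-preserving (translation S clifford a) (λ _ _ → translate-≡⇒γEq) good)
    from : (∀ a → Γ.DUpper a k) → 𝕊.DUpper k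
    from bound m s good = bound (stabiliser s) m _
      (Good-reflecting (translation S clifford (stabiliser s)) (λ i _ → H-⊕ (stabilised∈H s i))
        (𝕊.Good-resp (λ i → ≡.sym (H-identityʳ (stabilised∈H s i))) (λ _ → tt) (Good-stabilise s good)))

  DUpper-via-subgroups : ∀ k → 𝕊.DUpper k ⇔ (∀ T T-isSubgroup → 𝔾.DUpper T T-isSubgroup k)
  DUpper-via-subgroups k = mk⇔ to from
    where
    to : 𝕊.DUpper k → ∀ T T-isSubgroup → 𝔾.DUpper T T-isSubgroup k
    to bound T T-isSubgroup m s good = bound m s (Good-preserving (inclusion S T T-isSubgroup) (λ _ _ x≡y → x≡y) good)
    from : (∀ T T-isSubgroup → 𝔾.DUpper T T-isSubgroup k) → 𝕊.DUpper k
    from bound m s good = bound (H-class f) (H-class-isSubgroup f) m _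
      (Good-reflecting (inclusion S (H-class f) (H-class-isSubgroup f)) (λ i → ∈-toSubset⁺ (H? S f) (stabilised∈H s i))
        (Good-stabilise s good))
      where
      f = stabiliser s

corollary3p3 : ∀ {c ℓ : Level} (S : FinCommSemigroup) (K : Field c ℓ)
  → IsClifford S
  → ((∃ λ N → IsExp S N × RootsOfUnityCount K N)
     ⊎ (∃ λ p → Prime p × CharIs K p × ∃ λ N → IsExp S N × ∃ λ k → N ≡ p ^ k))
  → (∀ (a : Fin (FinCommSemigroup.size S))
       → εIsZero S a
       × IsSubgroup S (H S a) × H S a a
       × (∀ (P : Fin (FinCommSemigroup.size S) → Set) → IsSubgroup S P → P a
            → ∀ x → P x → H S a x)
       × SchutzenbergerIso S a)
  × (∀ (k : ℕ)
       → (DInv.DUpper S K (λ _ → ⊤) (λ _ → yes tt) _≡_ _≟_ k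
            ⇔ (∀ (a : Fin (FinCommSemigroup.size S))
                 → DInv.DUpper S K (St S a) (St? S a) (γEq S a) (γEq? S a) k))
       × (DInv.DUpper S K (λ _ → ⊤) (λ _ → yes tt) _≡_ _≟_ k
            ⇔ (∀ (T : Subset (FinCommSemigroup.size S)) → IsSubgroup S (λ x → x ∈ T)
                 → DInv.DUpper S K (λ x → x ∈ T) (λ x → x ∈? T) _≡_ _≟_ k)))
corollary3p3 S K clifford _ =
    (λ a → ⟨⟩-isSubgroup a , H-isSubgroup a , H-refl a , H-maximal a , schützenbergerIso a)
  , λ k → DUpper-via-Schützenberger k , DUpper-via-subgroups k
  where
  open Clifford S clifford
  open Reduction S clifford K
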